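{- For $i\in[2]$ let $G_i=C_{n_i}$ with $n_i\geq 3$ (the two cycles vertex-disjoint), and let $u_iv_i\in E(G_i)$. Let $G$ be the graph obtained from $G_1\cup G_2$ by identifying $u_1$ and $u_2$ as a single vertex $u$ and $v_1$ and $v_2$ as a single vertex $v$. Then for each $m\geq 3$: if $n_1$ and $n_2$ are both even, $$P_{DP}(G,m)=\frac{1}{m}\left((m-1)^{n_1+n_2-1}-(m-1)^{n_1-1}-(m-1)^{n_2-1}-m-1\right);$$ otherwise, $$P_{DP}(G,m)=\frac{P_{DP}(G_1,m)P_{DP}(G_2,m)}{m(m-1)}.$$
   Context: All graphs are finite and simple; $C_n$ is the cycle on $n$ vertices. A cover of a graph $G$ is a pair $\mathcal{H}=(L,H)$ where $H$ is a graph and $L:V(G)\to\mathcal{P}(V(H))$ satisfies: (1) $\{L(u):u\in V(G)\}$ is a partition of $V(H)$ into $|V(G)|$ parts; (2) $H[L(u)]$ is complete for each $u$; (3) if $E_H(L(u),L(v))$ is nonempty then $u=v$ or $uv\in E(G)$; (4) if $uv\in E(G)$ then $E_H(L(u),L(v))$ is a (possibly empty) matching. $\mathcal{H}$ is $m$-fold if $|L(u)|=m$ for all $u$. An $\mathcal{H}$-coloring of $G$ is an independent set of $H$ of size $|V(G)|$. The DP color function $P_{DP}(G,m)$ is the minimum number of $\mathcal{H}$-colorings of $G$ over all $m$-fold covers $\mathcal{H}$ of $G$. -}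

module Defs where

open import Data.Nat using (ℕ; zero; suc; _+_; _*_; _∸_; _^_; _≤_)
open import Data.Nat.Properties using (_≟_)
open import Data.Fin using (Fin; toℕ)
open import Data.Vec using (Vec; []; _∷_; lookup)
open import Data.List using (List; [_]; map; concatMap; filter; length; foldr)
open import Data.List.Base using (allFin)
open import Data.Bool using (Bool; true; false; not; T; _∧_)
open import Data.Product using (Σ; ∃; _×_; _,_)
open import Data.Sum using (_⊎_)
open import Relation.Nullary using (¬_; does)
open import Relation.Binary.PropositionalEquality using (_≡_)

record Graph : Set₁ where
  field
    order : ℕ
    Adj   : Fin order → Fin order → Set

open Graph public

-- Without loss of generality V(H) = V(G) × Fin m and
-- L(u) = {u} × Fin m (every m-fold cover is isomorphic to one of this form,
-- and the number of H-colorings is an isomorphism invariant).  Each L(u) is a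
-- clique (condition (2)); the cross edges are given by the Boolean relation
-- M u v i j  meaning  (u,i)(v,j) ∈ E(H)  for u ≠ v.
record Cover (G : Graph) (m : ℕ) : Set where
  field
    M      : Fin (order G) → Fin (order G) → Fin m → Fin m → Bool
    M-sym  : ∀ u v i j → M u v i j ≡ M v u j i
    M-adj  : ∀ u v i j → M u v i j ≡ true → Adj G u v
    M-matchʳ : ∀ u v i j j' → M u v i j ≡ true → M u v i j' ≡ true → j ≡ j'
    M-matchˡ : ∀ u v i i' j → M u v i j ≡ true → M u v i' j ≡ true → i ≡ i'

open Cover public

allVecs : (m n : ℕ) → List (Vec (Fin m) n)
allVecs m zero    = [ [] ]
allVecs m (suc n) = concatMap (λ i → map (i ∷_) (allVecs m n)) (allFin m)

allB : {A : Set} → (A → Bool) → List A → Bool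
allB p = foldr (λ x b → p x ∧ b) true

-- Since each L(u) is a clique, an independent set of H of size |V(G)| is
-- exactly a choice c(u) ∈ L(u) for every u with no H-edge between the chosen
-- vertices; we encode it as c : Vec (Fin m) |V(G)|.
isHColoring : {G : Graph} {m : ℕ} → Cover G m → Vec (Fin m) (order G) → Bool
isHColoring {G} H c =
  allB (λ u → allB (λ v → not (M H u v (lookup c u) (lookup c v)))
                 (allFin (order G)))
      (allFin (order G))

numColorings : {G : Graph} {m : ℕ} → Cover G m → ℕ
numColorings {G} {m} H = length (filter (λ c → T? (isHColoring H c)) (allVecs m (order G)))
  where
  open import Relation.Nullary.Decidable using (Dec)
  open import Data.Bool.Properties using (T?)

IsPDP : Graph → ℕ → ℕ → Set
IsPDP G m k = (Σ (Cover G m) λ H → numColorings H ≡ k)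
            × (∀ (H : Cover G m) → k ≤ numColorings H)

CycAdj : ℕ → ℕ → ℕ → Set
CycAdj n a b = (suc a ≡ b) ⊎ (suc b ≡ a) ⊎ (a ≡ 0 × suc b ≡ n) ⊎ (b ≡ 0 × suc a ≡ n)

Cycle : ℕ → Graph
Cycle n = record { order = n ; Adj = λ x y → CycAdj n (toℕ x) (toℕ y) }

-- G_1 = C_{n1} on codes 0..n1-1 with u_1 = 0, v_1 = n1-1 (an edge of G_1).
-- G_2 = C_{n2} on 0..n2-1 with u_2 = 0, v_2 = n2-1 (an edge of G_2).
-- The identification map from V(G_2) into V(G): u_2 ↦ u = 0, v_2 ↦ v = n1-1,
-- the internal vertices 1..n2-2 of G_2 ↦ fresh codes n1..n1+n2-3.
φ : ℕ → ℕ → ℕ → ℕ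
φ n1 n2 zero = zero
φ n1 n2 (suc x) with does (suc (suc x) ≟ n2)
... | true  = n1 ∸ 1
... | false = n1 + x

ThetaGraph : ℕ → ℕ → Graph
ThetaGraph n1 n2 = record
  { order = n1 + (n2 ∸ 2)
  ; Adj = λ a b →
      (Σ (Fin n1) λ x → Σ (Fin n1) λ y →
          toℕ x ≡ toℕ a × toℕ y ≡ toℕ b × CycAdj n1 (toℕ x) (toℕ y))
    ⊎ (Σ (Fin n2) λ x → Σ (Fin n2) λ y →
          φ n1 n2 (toℕ x) ≡ toℕ a × φ n1 n2 (toℕ y) ≡ toℕ b × CycAdj n2 (toℕ x) (toℕ y))
  }

-- Colour u with i and v with j. The H-colourings of C_n, resp. of G, with these end colours number
-- [i and j are not joined across uv] times the product, over the u–v paths other than uv, of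
-- P(i, j): the number of colourings of the path with end colours i and j, an entry of a product of
-- transfer matrices "not joined by the link".
--
-- By induction along a path with L edges, for every j the column P(·, j) is at least a_L, where
-- m a_L = (m − 1)^L − (−1)^L, except in one row, where it is at least a_L + 1 (L even) or only at
-- least a_L − 1 (L odd); the odd step uses that a matching with an empty column has an empty row.
-- As the uv-link removes at most one row from every column, summing gives
--   #C_n-colourings ≥ m (m − 1) a_L − m [L odd]                          (L = n − 1),
--   #G-colourings   ≥ m (m − 1) a₁ a₂ − m ([L₁ odd] a₂ + [L₂ odd] a₁),
-- with equality for covers whose links are identities except for cyclic shifts on uv and on the
-- first edge of the second path, placed so that the uv-link blocks the surplus rows and misses the
-- deficit rows, which are distinct. Both claims then follow by algebra: if n₁ and n₂ are even, both
-- paths are odd and m a_L = (m − 1)^L + 1; otherwise one bracket vanishes and the cycle values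
-- multiply.

{-# OPTIONS --safe #-}
module Submission where

open import Defs

open import Data.Bool as Bool using (Bool; true; false; not; _∧_; if_then_else_)
open import Data.Bool.Properties as Boolₚ using (T?; ∧-identityʳ)
open import Data.Fin as Fin using (Fin; zero; suc; toℕ; inject₁; fromℕ)
import Data.Fin.Properties as Finₚ
open import Data.Fin.Permutation as Permutation using (Permutation′; _⟨$⟩ʳ_; _⟨$⟩ˡ_; _∘ₚ_)
open import Data.List as List using (List; filter; length; concatMap; _++_)
open import Data.Nat using (ℕ; zero; suc; _+_; _*_; _∸_; _^_; _≤_; z≤n; s≤s; NonZero; >-nonZero)
open import Data.Nat.Properties
open import Data.Nat.Divisibility using (_∣_; divides; ∣-refl; ∣m∣n⇒∣m+n; ∣m+n∣m⇒∣n; ∣1⇒≡1)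
open import Data.Nat.Tactic.RingSolver using (solve-∀)
open import Algebra.Properties.Semiring.Sum +-*-semiring
  using (sum; sum-syntax; sum-cong-≗; ∑-distrib-+; ∑-comm; *-distribˡ-sum; *-distribʳ-sum)
open import Data.Product using (Σ; ∃; _×_; _,_; proj₁; proj₂)
open import Data.Product.Function.NonDependent.Propositional using (_×-⇔_)
open import Data.Sum using (_⊎_; inj₁; inj₂)
open import Data.Vec as Vec using (Vec; []; _∷_; _∷ʳ_; lookup)
import Data.Vec.Properties as Vecₚ
open import Function using (_∘_; id; flip; _⇔_; mk⇔; Equivalence; Injection)
open import Function.Construct.Identity using (⇔-id)
open import Function.Construct.Symmetry using (⇔-sym)
open import Function.Properties.Inverse using (↔⇒↣)
open import Function.Related.Propositional using (module EquationalReasoning)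
open import Relation.Binary.PropositionalEquality
open import Relation.Nullary using (¬_; Dec; yes; no; does; contradiction)
open import Relation.Nullary.Decidable using (dec-true; dec-false; _×-dec_; _⊎-dec_)

private
  variable
    m n : ℕ

≡true⇔⇒≡ : {a b : Bool} → (a ≡ true ⇔ b ≡ true) → a ≡ b
≡true⇔⇒≡ {true}  {true}  _   = refl
≡true⇔⇒≡ {true}  {false} a⇔b = sym (Equivalence.to a⇔b refl)
≡true⇔⇒≡ {false} {true}  a⇔b = Equivalence.from a⇔b refl
≡true⇔⇒≡ {false} {false} _   = refl

∧≡true⇔ : {a b : Bool} → (a ∧ b) ≡ true ⇔ (a ≡ true × b ≡ true)
∧≡true⇔ {true}  = mk⇔ (refl ,_) proj₂
∧≡true⇔ {false} = mk⇔ (λ ()) (λ ())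

not≡true⇔ : {a : Bool} → not a ≡ true ⇔ a ≡ false
not≡true⇔ {true}  = mk⇔ (λ ()) (λ ())
not≡true⇔ {false} = mk⇔ (λ _ → refl) (λ _ → refl)

not∧≡true⇔ : {a b : Bool} → (not a ∧ b) ≡ true ⇔ (a ≡ false × b ≡ true)
not∧≡true⇔ {true}  = mk⇔ (λ ()) (λ ())
not∧≡true⇔ {false} = mk⇔ (refl ,_) proj₂

allB-tabulate⇔ : {A : Set} (p : A → Bool) (f : Fin n → A) →
                 allB p (List.tabulate f) ≡ true ⇔ (∀ i → p (f i) ≡ true)
allB-tabulate⇔ {zero}  p f = mk⇔ (λ _ ()) (λ _ → refl)
allB-tabulate⇔ {suc n} p f = mk⇔
  (λ h → let h₀ , h₊ = Equivalence.to ∧≡true⇔ h in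
         λ { zero → h₀ ; (suc i) → Equivalence.to (allB-tabulate⇔ p (f ∘ suc)) h₊ i })
  (λ h → Equivalence.from ∧≡true⇔ (h zero , Equivalence.from (allB-tabulate⇔ p (f ∘ suc)) (h ∘ suc)))

⟦_⟧ : Bool → ℕ
⟦ true  ⟧ = 1
⟦ false ⟧ = 0

⟦∧⟧ : ∀ b c → ⟦ b ∧ c ⟧ ≡ ⟦ b ⟧ * ⟦ c ⟧
⟦∧⟧ true  c = sym (+-identityʳ ⟦ c ⟧)
⟦∧⟧ false c = refl

⟦⟧≤1 : ∀ b → ⟦ b ⟧ ≤ 1
⟦⟧≤1 true  = s≤s z≤n
⟦⟧≤1 false = z≤n

infix 4 _==_

_==_ : Fin m → Fin m → Bool
i == j = does (i Fin.≟ j)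

==-refl : (i : Fin m) → (i == i) ≡ true
==-refl i = dec-true (i Fin.≟ i) refl

==⇒≡ : {i j : Fin m} → (i == j) ≡ true → i ≡ j
==⇒≡ {i = i} {j} eq with i Fin.≟ j
... | yes i≡j = i≡j

≢⇒==-false : {i j : Fin m} → i ≢ j → (i == j) ≡ false
≢⇒==-false {i = i} {j} = dec-false (i Fin.≟ j)

==-sym : (i j : Fin m) → (i == j) ≡ (j == i)
==-sym i j with i Fin.≟ j | j Fin.≟ i
... | yes _   | yes _   = refl
... | no _    | no _    = refl
... | yes i≡j | no j≢i  = contradiction (sym i≡j) j≢i
... | no i≢j  | yes j≡i = contradiction (sym j≡i) i≢j

sum-const : ∀ n c → ∑[ i < n ] c ≡ n * c
sum-const zero    c = refl
sum-const (suc n) c = cong (c +_) (sum-const n c)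

sum-mono-≤ : {f g : Fin n → ℕ} → (∀ i → f i ≤ g i) → sum f ≤ sum g
sum-mono-≤ {zero}  f≤g = z≤n
sum-mono-≤ {suc n} f≤g = +-mono-≤ (f≤g zero) (sum-mono-≤ (f≤g ∘ suc))

sum-select : (f : Fin m → ℕ) (p : Fin m) → ∑[ y < m ] (⟦ y == p ⟧ * f y) ≡ f p
sum-select {suc m} f zero = begin
  f zero + 0 + ∑[ y < m ] 0 ≡⟨ cong₂ _+_ (+-identityʳ (f zero)) (sum-const m 0) ⟩
  f zero + m * 0           ≡⟨ cong (f zero +_) (*-zeroʳ m) ⟩
  f zero + 0               ≡⟨ +-identityʳ (f zero) ⟩
  f zero                   ∎
  where open ≡-Reasoning
sum-select {suc m} f (suc p) = sum-select (f ∘ suc) p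

sum-indicator : (p : Fin m) → ∑[ y < m ] ⟦ y == p ⟧ ≡ 1
sum-indicator p = trans (sum-cong-≗ (λ y → sym (*-identityʳ ⟦ y == p ⟧))) (sum-select (λ _ → 1) p)

sum-permuted-indicator : (ρ : Permutation′ m) (b : Bool) (j : Fin m) → ∑[ i < m ] ⟦ b ∧ (ρ ⟨$⟩ʳ i == j) ⟧ ≡ ⟦ b ⟧
sum-permuted-indicator {m} ρ b j = begin
  ∑[ i < m ] ⟦ b ∧ (ρ ⟨$⟩ʳ i == j) ⟧      ≡⟨ sum-cong-≗ (λ i → trans (⟦∧⟧ b _) (cong (λ t → ⟦ b ⟧ * ⟦ t ⟧) (moved i))) ⟩
  ∑[ i < m ] (⟦ b ⟧ * ⟦ i == ρ ⟨$⟩ˡ j ⟧)  ≡˘⟨ *-distribˡ-sum ⟦ b ⟧ (λ i → ⟦ i == ρ ⟨$⟩ˡ j ⟧) ⟩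
  ⟦ b ⟧ * ∑[ i < m ] ⟦ i == ρ ⟨$⟩ˡ j ⟧    ≡⟨ cong (⟦ b ⟧ *_) (sum-indicator (ρ ⟨$⟩ˡ j)) ⟩
  ⟦ b ⟧ * 1                               ≡⟨ *-identityʳ ⟦ b ⟧ ⟩
  ⟦ b ⟧                                   ∎
  where
  open ≡-Reasoning
  moved : ∀ i → (ρ ⟨$⟩ʳ i == j) ≡ (i == ρ ⟨$⟩ˡ j)
  moved i = ≡true⇔⇒≡ (mk⇔
    (λ ρi≡j → dec-true (i Fin.≟ ρ ⟨$⟩ˡ j) (trans (sym (Permutation.inverseˡ ρ)) (cong (ρ ⟨$⟩ˡ_) (==⇒≡ ρi≡j))))
    (λ i≡ρ⁻¹j → dec-true (ρ ⟨$⟩ʳ i Fin.≟ j) (trans (cong (ρ ⟨$⟩ʳ_) (==⇒≡ i≡ρ⁻¹j)) (Permutation.inverseʳ ρ))))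

sum-bump : ∀ {m′} (π : Fin (suc m′)) A → ∑[ y < suc m′ ] (⟦ y == π ⟧ + A) ≡ 1 + (A + m′ * A)
sum-bump {m′} π A = trans (∑-distrib-+ (λ y → ⟦ y == π ⟧) (λ _ → A)) (cong₂ _+_ (sum-indicator π) (sum-const (suc m′) A))

sum-lowerBound : ∀ {c e} (F : Fin m → ℕ) → (∀ j → c ≤ F j + e) → m * c ≤ sum F + m * e
sum-lowerBound {m} {c} {e} F c≤F+e = begin
  m * c                            ≡˘⟨ sum-const m c ⟩
  ∑[ j < m ] c                     ≤⟨ sum-mono-≤ c≤F+e ⟩
  ∑[ j < m ] (F j + e)             ≡⟨ ∑-distrib-+ F (λ _ → e) ⟩
  sum F + ∑[ j < m ] e             ≡⟨ cong (sum F +_) (sum-const m e) ⟩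
  sum F + m * e                    ∎
  where open ≤-Reasoning

sum-exact : ∀ {c V} (F : Fin m → ℕ) → (∀ j → F j + c ≡ V) → sum F + m * c ≡ m * V
sum-exact {m} {c} {V} F F+c≡V = begin
  sum F + m * c          ≡˘⟨ cong (sum F +_) (sum-const m c) ⟩
  sum F + ∑[ j < m ] c   ≡˘⟨ ∑-distrib-+ F (λ _ → c) ⟩
  ∑[ j < m ] (F j + c)   ≡⟨ trans (sum-cong-≗ F+c≡V) (sum-const m V) ⟩
  m * V                  ∎
  where open ≡-Reasoning

-- Colourings as iterated sums

∑ⱽ : ∀ n → (Vec (Fin m) n → ℕ) → ℕ
∑ⱽ zero    F = F []
∑ⱽ (suc n) F = ∑[ i < _ ] ∑ⱽ n (λ x → F (i ∷ x))

∑ⱽ-cong : ∀ n {F G : Vec (Fin m) n → ℕ} → (∀ x → F x ≡ G x) → ∑ⱽ n F ≡ ∑ⱽ n G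
∑ⱽ-cong zero    F≗G = F≗G []
∑ⱽ-cong (suc n) F≗G = sum-cong-≗ (λ i → ∑ⱽ-cong n (λ x → F≗G (i ∷ x)))

∑ⱽ-*ˡ : ∀ n c (F : Vec (Fin m) n → ℕ) → ∑ⱽ n (λ x → c * F x) ≡ c * ∑ⱽ n F
∑ⱽ-*ˡ zero    c F = refl
∑ⱽ-*ˡ (suc n) c F = trans (sum-cong-≗ (λ i → ∑ⱽ-*ˡ n c (λ x → F (i ∷ x))))
                          (sym (*-distribˡ-sum c (λ i → ∑ⱽ n (λ x → F (i ∷ x)))))

∑ⱽ-comm : ∀ n {k} (F : Vec (Fin m) n → Fin k → ℕ) →
          ∑ⱽ n (λ x → ∑[ j < k ] F x j) ≡ ∑[ j < k ] ∑ⱽ n (λ x → F x j)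
∑ⱽ-comm zero    F = refl
∑ⱽ-comm (suc n) F = trans (sum-cong-≗ (λ i → ∑ⱽ-comm n (λ x → F (i ∷ x))))
                          (∑-comm (λ i j → ∑ⱽ n (λ x → F (i ∷ x) j)))

∑ⱽ-∷ʳ : ∀ n (F : Vec (Fin m) (suc n) → ℕ) → ∑ⱽ (suc n) F ≡ ∑ⱽ n (λ x → ∑[ j < m ] F (x ∷ʳ j))
∑ⱽ-∷ʳ zero    F = refl
∑ⱽ-∷ʳ (suc n) F = sum-cong-≗ (λ i → ∑ⱽ-∷ʳ n (λ x → F (i ∷ x)))

∑ⱽ-++ : ∀ a b (F : Vec (Fin m) (a + b) → ℕ) → ∑ⱽ (a + b) F ≡ ∑ⱽ a (λ p → ∑ⱽ b (λ q → F (p Vec.++ q)))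
∑ⱽ-++ zero    b F = refl
∑ⱽ-++ (suc a) b F = sum-cong-≗ (λ i → ∑ⱽ-++ a b (λ x → F (i ∷ x)))

∑ⱽ-product : ∀ a b (F : Vec (Fin m) a → ℕ) (G : Vec (Fin m) b → ℕ) →
             ∑ⱽ a (λ p → ∑ⱽ b (λ q → F p * G q)) ≡ ∑ⱽ a F * ∑ⱽ b G
∑ⱽ-product a b F G = trans (∑ⱽ-cong a (λ p → ∑ⱽ-*ˡ b (F p) G))
                           (trans (∑ⱽ-cong a (λ p → *-comm (F p) _)) (trans (∑ⱽ-*ˡ a (∑ⱽ b G) F) (*-comm (∑ⱽ b G) (∑ⱽ a F))))

countTrue : {A : Set} → (A → Bool) → List A → ℕ
countTrue p xs = length (filter (T? ∘ p) xs)

countTrue-++ : {A : Set} (p : A → Bool) (xs ys : List A) →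
               countTrue p (xs ++ ys) ≡ countTrue p xs + countTrue p ys
countTrue-++ p List.[]       ys = refl
countTrue-++ p (x List.∷ xs) ys with p x
... | true  = cong suc (countTrue-++ p xs ys)
... | false = countTrue-++ p xs ys

countTrue-map : {A B : Set} (p : B → Bool) (f : A → B) (xs : List A) →
                countTrue p (List.map f xs) ≡ countTrue (p ∘ f) xs
countTrue-map p f List.[]       = refl
countTrue-map p f (x List.∷ xs) with p (f x)
... | true  = cong suc (countTrue-map p f xs)
... | false = countTrue-map p f xs

countTrue-concatMap : {A B : Set} (p : B → Bool) (g : A → List B) (f : Fin n → A) →
                      countTrue p (concatMap g (List.tabulate f)) ≡ ∑[ i < n ] countTrue p (g (f i))
countTrue-concatMap {zero}  p g f = refl
countTrue-concatMap {suc n} p g f =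
  trans (countTrue-++ p (g (f zero)) _) (cong (countTrue p (g (f zero)) +_) (countTrue-concatMap p g (f ∘ suc)))

countTrue-allVecs : ∀ n (p : Vec (Fin m) n → Bool) → countTrue p (allVecs m n) ≡ ∑ⱽ n (⟦_⟧ ∘ p)
countTrue-allVecs zero p with p []
... | true  = refl
... | false = refl
countTrue-allVecs {m} (suc n) p =
  trans (countTrue-concatMap p (λ i → List.map (i ∷_) (allVecs m n)) id)
        (sum-cong-≗ (λ i → trans (countTrue-map p (i ∷_) (allVecs m n)) (countTrue-allVecs n (p ∘ (i ∷_)))))

numColorings-∑ⱽ : {G : Graph} (H : Cover G m) → numColorings H ≡ ∑ⱽ (order G) (⟦_⟧ ∘ isHColoring H)
numColorings-∑ⱽ {m} {G} H = countTrue-allVecs (order G) (isHColoring H)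

Proper : {G : Graph} → Cover G m → Vec (Fin m) (order G) → Set
Proper {G = G} H c = ∀ a b → Adj G a b → M H a b (lookup c a) (lookup c b) ≡ false

isHColoring⇔Proper : {G : Graph} (H : Cover G m) (c : Vec (Fin m) (order G)) →
                     isHColoring H c ≡ true ⇔ Proper H c
isHColoring⇔Proper {G = G} H c = mk⇔
  (λ h a b _ → Equivalence.to not≡true⇔ (Equivalence.to (row⇔ a) (Equivalence.to all⇔ h a) b))
  (λ h → Equivalence.from all⇔ (λ a → Equivalence.from (row⇔ a) (λ b →
           Equivalence.from not≡true⇔ (noEdge a b (h a b)))))
  where
  edge : Fin (order G) → Fin (order G) → Bool
  edge a b = M H a b (lookup c a) (lookup c b)
  row⇔ : ∀ a → allB (λ b → not (edge a b)) (List.allFin (order G)) ≡ true ⇔ (∀ b → not (edge a b) ≡ true)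
  row⇔ a = allB-tabulate⇔ (λ b → not (edge a b)) id
  all⇔ : isHColoring H c ≡ true ⇔ (∀ a → allB (λ b → not (edge a b)) (List.allFin (order G)) ≡ true)
  all⇔ = allB-tabulate⇔ (λ a → allB (λ b → not (edge a b)) (List.allFin (order G))) id
  noEdge : ∀ a b → (Adj G a b → edge a b ≡ false) → edge a b ≡ false
  noEdge a b h with edge a b in eq
  ... | true  = h (M-adj H a b _ _ eq)
  ... | false = refl

-- Paths

Link : ℕ → Set
Link m = Fin m → Fin m → Bool

avoids : ∀ {k} → (Fin k → Link m) → Vec (Fin m) (suc k) → Bool
avoids {k = zero}  Rs (_ ∷ [])    = true
avoids {k = suc k} Rs (x ∷ y ∷ w) = not (Rs zero x y) ∧ avoids (Rs ∘ suc) (y ∷ w)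

avoids⇔ : ∀ {k} (Rs : Fin k → Link m) (w : Vec (Fin m) (suc k)) →
          avoids Rs w ≡ true ⇔ (∀ s → Rs s (lookup w (inject₁ s)) (lookup w (suc s)) ≡ false)
avoids⇔ {k = zero}  Rs (_ ∷ [])    = mk⇔ (λ _ ()) (λ _ → refl)
avoids⇔ {k = suc k} Rs (x ∷ y ∷ w) with Rs zero x y in eq
... | true  = mk⇔ (λ ()) (λ h → contradiction (trans (sym eq) (h zero)) λ ())
... | false = mk⇔ (λ h → λ { zero → eq ; (suc s) → Equivalence.to (avoids⇔ (Rs ∘ suc) (y ∷ w)) h s })
                  (λ h → Equivalence.from (avoids⇔ (Rs ∘ suc) (y ∷ w)) (h ∘ suc))

step : Link m → (Fin m → ℕ) → Fin m → ℕ
step R f i = ∑[ y < _ ] (⟦ not (R i y) ⟧ * f y)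

pathCount : ∀ {L} → (Fin L → Link m) → Fin m → Fin m → ℕ
pathCount {L = zero}  Rs i j = ⟦ i == j ⟧
pathCount {L = suc L} Rs i j = step (Rs zero) (λ y → pathCount (Rs ∘ suc) y j) i

pathCount-cong : ∀ {L} {Rs Rs′ : Fin L → Link m} → (∀ s i y → Rs s i y ≡ Rs′ s i y) →
                 ∀ i j → pathCount Rs i j ≡ pathCount Rs′ i j
pathCount-cong {L = zero}  Rs≗Rs′ i j = refl
pathCount-cong {L = suc L} Rs≗Rs′ i j = sum-cong-≗ (λ y →
  cong₂ (λ b p → ⟦ not b ⟧ * p) (Rs≗Rs′ zero i y) (pathCount-cong (Rs≗Rs′ ∘ suc) y j))

idPathCount : ∀ L → Fin m → Fin m → ℕ
idPathCount L = pathCount {L = L} (λ _ → _==_)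

∑ⱽ-avoids : ∀ k (Rs : Fin (suc k) → Link m) i j →
            ∑ⱽ k (λ x → ⟦ avoids Rs (i ∷ (x ∷ʳ j)) ⟧) ≡ pathCount Rs i j
∑ⱽ-avoids zero    Rs i j = begin
  ⟦ not (Rs zero i j) ∧ true ⟧                    ≡⟨ cong ⟦_⟧ (∧-identityʳ _) ⟩
  ⟦ not (Rs zero i j) ⟧                           ≡˘⟨ sum-select (λ y → ⟦ not (Rs zero i y) ⟧) j ⟩
  ∑[ y < _ ] (⟦ y == j ⟧ * ⟦ not (Rs zero i y) ⟧) ≡⟨ sum-cong-≗ (λ y → *-comm ⟦ y == j ⟧ _) ⟩
  pathCount Rs i j                                ∎
  where open ≡-Reasoning
∑ⱽ-avoids (suc k) Rs i j = sum-cong-≗ λ y → begin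
  ∑ⱽ k (λ x → ⟦ not (Rs zero i y) ∧ avoids (Rs ∘ suc) (y ∷ (x ∷ʳ j)) ⟧)
    ≡⟨ ∑ⱽ-cong k (λ x → ⟦∧⟧ (not (Rs zero i y)) _) ⟩
  ∑ⱽ k (λ x → ⟦ not (Rs zero i y) ⟧ * ⟦ avoids (Rs ∘ suc) (y ∷ (x ∷ʳ j)) ⟧)
    ≡⟨ ∑ⱽ-*ˡ k ⟦ not (Rs zero i y) ⟧ _ ⟩
  ⟦ not (Rs zero i y) ⟧ * ∑ⱽ k (λ x → ⟦ avoids (Rs ∘ suc) (y ∷ (x ∷ʳ j)) ⟧)
    ≡⟨ cong (⟦ not (Rs zero i y) ⟧ *_) (∑ⱽ-avoids k (Rs ∘ suc) y j) ⟩
  ⟦ not (Rs zero i y) ⟧ * pathCount (Rs ∘ suc) y j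
    ∎
  where open ≡-Reasoning

-- Cycles and theta graphs

module _ {k : ℕ} (Q : Fin (suc (suc k)) → Fin (suc (suc k)) → Set) (Q-sym : ∀ {a b} → Q a b → Q b a) where

  private
    consecutive : (∀ s → Q (inject₁ s) (suc s)) → ∀ a b → suc (toℕ a) ≡ toℕ b → Q a b
    consecutive h a zero    ()
    consecutive h a (suc s) a+1≡b =
      subst (λ x → Q x (suc s)) (Finₚ.toℕ-injective (trans (Finₚ.toℕ-inject₁ s) (sym (suc-injective a+1≡b)))) (h s)

    closing : Q zero (fromℕ (suc k)) → ∀ a b → toℕ a ≡ 0 → suc (toℕ b) ≡ suc (suc k) → Q a b
    closing h a b a≡0 b≡last = subst₂ Q (Finₚ.toℕ-injective {i = zero} (sym a≡0))
      (Finₚ.toℕ-injective (trans (Finₚ.toℕ-fromℕ (suc k)) (sym (suc-injective b≡last)))) h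

  cycle-edges⇔ : (∀ a b → Adj (Cycle (suc (suc k))) a b → Q a b) ⇔
                 ((∀ s → Q (inject₁ s) (suc s)) × Q zero (fromℕ (suc k)))
  cycle-edges⇔ = mk⇔
    (λ h → (λ s → h _ _ (inj₁ (cong suc (Finₚ.toℕ-inject₁ s))))
         , h _ _ (inj₂ (inj₂ (inj₁ (refl , cong suc (Finₚ.toℕ-fromℕ (suc k)))))))
    λ { (h , h₀) a b (inj₁ a+1≡b)                   → consecutive h a b a+1≡b
      ; (h , h₀) a b (inj₂ (inj₁ b+1≡a))            → Q-sym (consecutive h b a b+1≡a)
      ; (h , h₀) a b (inj₂ (inj₂ (inj₁ (a≡0 , b≡)))) → closing h₀ a b a≡0 b≡
      ; (h , h₀) a b (inj₂ (inj₂ (inj₂ (b≡0 , a≡)))) → Q-sym (closing h₀ b a b≡0 a≡) }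

pathLinks : {G : Graph} → Cover G m → ∀ {k} → (Fin (suc k) → Fin (order G)) → Fin k → Link m
pathLinks H e s = M H (e (inject₁ s)) (e (suc s))

embeddedCycle⇔ : {G : Graph} (H : Cover G m) {k : ℕ} (e : Fin (suc (suc k)) → Fin (order G))
                 (c : Vec (Fin m) (order G)) (w : Vec (Fin m) (suc (suc k))) →
                 (∀ t → lookup c (e t) ≡ lookup w t) →
                 (∀ x y → Adj (Cycle (suc (suc k))) x y → M H (e x) (e y) (lookup c (e x)) (lookup c (e y)) ≡ false)
                 ⇔ (M H (e zero) (e (fromℕ (suc k))) (lookup w zero) (lookup w (fromℕ (suc k))) ≡ false ×
                    avoids (pathLinks H e) w ≡ true)
embeddedCycle⇔ H {k} e c w c∘e≡w = mk⇔
  (λ h → let hs , h₀ = Equivalence.to cycle⇔ h in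
         toW h₀ , Equivalence.from (avoids⇔ (pathLinks H e) w) (λ s → toW (hs s)))
  (λ (h₀ , hs) → Equivalence.from cycle⇔
         ((λ s → toC (Equivalence.to (avoids⇔ (pathLinks H e) w) hs s)) , toC h₀))
  where
  Fine : Fin (suc (suc k)) → Fin (suc (suc k)) → Set
  Fine x y = M H (e x) (e y) (lookup c (e x)) (lookup c (e y)) ≡ false
  cycle⇔ : (∀ x y → Adj (Cycle (suc (suc k))) x y → Fine x y) ⇔
           ((∀ s → Fine (inject₁ s) (suc s)) × Fine zero (fromℕ (suc k)))
  cycle⇔ = cycle-edges⇔ Fine (λ {x} {y} → trans (M-sym H (e y) (e x) _ _))
  toW : ∀ {x y} → Fine x y → M H (e x) (e y) (lookup w x) (lookup w y) ≡ false
  toW {x} {y} = subst₂ (λ u v → M H (e x) (e y) u v ≡ false) (c∘e≡w x) (c∘e≡w y)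
  toC : ∀ {x y} → M H (e x) (e y) (lookup w x) (lookup w y) ≡ false → Fine x y
  toC {x} {y} = subst₂ (λ u v → M H (e x) (e y) u v ≡ false) (sym (c∘e≡w x)) (sym (c∘e≡w y))

lookup-∷ʳ-fromℕ : {A : Set} (x : Vec A n) (j : A) → lookup (x ∷ʳ j) (fromℕ n) ≡ j
lookup-∷ʳ-fromℕ []      j = refl
lookup-∷ʳ-fromℕ (_ ∷ x) j = lookup-∷ʳ-fromℕ x j

lookup-∷ʳ : {A : Set} (xs : Vec A n) (y : A) (t : Fin (suc n)) →
            (toℕ t ≡ n × lookup (xs ∷ʳ y) t ≡ y) ⊎
            (∃ λ u → toℕ u ≡ toℕ t × lookup (xs ∷ʳ y) t ≡ lookup xs u)
lookup-∷ʳ []       y zero    = inj₁ (refl , refl)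
lookup-∷ʳ (x ∷ xs) y zero    = inj₂ (zero , refl , refl)
lookup-∷ʳ (x ∷ xs) y (suc t) with lookup-∷ʳ xs y t
... | inj₁ (t≡n , eq)     = inj₁ (cong suc t≡n , eq)
... | inj₂ (u , u≡t , eq) = inj₂ (suc u , cong suc u≡t , eq)

module CycleCount {k : ℕ} (H : Cover (Cycle (suc (suc k))) m) where

  links : Fin (suc k) → Link m
  links = pathLinks H id

  closingLink : Link m
  closingLink = M H zero (fromℕ (suc k))

  isHColoring-cycle : ∀ i x j → isHColoring H (i ∷ (x ∷ʳ j)) ≡ not (closingLink i j) ∧ avoids links (i ∷ (x ∷ʳ j))
  isHColoring-cycle i x j = ≡true⇔⇒≡ (begin
    isHColoring H w ≡ true
      ∼⟨ isHColoring⇔Proper H w ⟩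
    Proper H w
      ∼⟨ embeddedCycle⇔ H id w w (λ _ → refl) ⟩
    (closingLink i (lookup w (fromℕ (suc k))) ≡ false × avoids links w ≡ true)
      ≡⟨ cong (λ u → closingLink i u ≡ false × avoids links w ≡ true) (lookup-∷ʳ-fromℕ x j) ⟩
    (closingLink i j ≡ false × avoids links w ≡ true)
      ∼⟨ ⇔-sym not∧≡true⇔ ⟩
    (not (closingLink i j) ∧ avoids links w) ≡ true
      ∎)
    where
    open EquationalReasoning
    w : Vec (Fin m) (suc (suc k))
    w = i ∷ (x ∷ʳ j)

  cycle-fixedEnds : ∀ i j → ∑ⱽ k (λ x → ⟦ isHColoring H (i ∷ (x ∷ʳ j)) ⟧) ≡ ⟦ not (closingLink i j) ⟧ * pathCount links i j
  cycle-fixedEnds i j = begin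
    ∑ⱽ k (λ x → ⟦ isHColoring H (i ∷ (x ∷ʳ j)) ⟧)
      ≡⟨ ∑ⱽ-cong k (λ x → trans (cong ⟦_⟧ (isHColoring-cycle i x j)) (⟦∧⟧ (not (closingLink i j)) _)) ⟩
    ∑ⱽ k (λ x → ⟦ not (closingLink i j) ⟧ * ⟦ avoids links (i ∷ (x ∷ʳ j)) ⟧)
      ≡⟨ ∑ⱽ-*ˡ k ⟦ not (closingLink i j) ⟧ (λ x → ⟦ avoids links (i ∷ (x ∷ʳ j)) ⟧) ⟩
    ⟦ not (closingLink i j) ⟧ * ∑ⱽ k (λ x → ⟦ avoids links (i ∷ (x ∷ʳ j)) ⟧)
      ≡⟨ cong (⟦ not (closingLink i j) ⟧ *_) (∑ⱽ-avoids k links i j) ⟩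
    ⟦ not (closingLink i j) ⟧ * pathCount links i j
      ∎
    where open ≡-Reasoning

  cycle-count : numColorings H ≡ ∑[ j < m ] ∑[ i < m ] (⟦ not (closingLink i j) ⟧ * pathCount links i j)
  cycle-count = begin
    numColorings H
      ≡⟨ numColorings-∑ⱽ H ⟩
    ∑[ i < m ] ∑ⱽ (suc k) (λ x → ⟦ isHColoring H (i ∷ x) ⟧)
      ≡⟨ sum-cong-≗ (λ i → ∑ⱽ-∷ʳ k (λ x → ⟦ isHColoring H (i ∷ x) ⟧)) ⟩
    ∑[ i < m ] ∑ⱽ k (λ x → ∑[ j < m ] ⟦ isHColoring H (i ∷ (x ∷ʳ j)) ⟧)
      ≡⟨ sum-cong-≗ (λ i → ∑ⱽ-comm k (λ x j → ⟦ isHColoring H (i ∷ (x ∷ʳ j)) ⟧)) ⟩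
    ∑[ i < m ] ∑[ j < m ] ∑ⱽ k (λ x → ⟦ isHColoring H (i ∷ (x ∷ʳ j)) ⟧)
      ≡⟨ sum-cong-≗ (λ i → sum-cong-≗ (λ j → cycle-fixedEnds i j)) ⟩
    ∑[ i < m ] ∑[ j < m ] (⟦ not (closingLink i j) ⟧ * pathCount links i j)
      ≡⟨ ∑-comm (λ i j → ⟦ not (closingLink i j) ⟧ * pathCount links i j) ⟩
    ∑[ j < m ] ∑[ i < m ] (⟦ not (closingLink i j) ⟧ * pathCount links i j)
      ∎
    where
    open ≡-Reasoning

-- ThetaGraph n₁ n₂ keeps the numbering 0, …, n₁ − 1 of the first cycle (u = 0, v = n₁ − 1); the
-- second cycle runs through u, the new vertices n₁, …, n₁ + r₂ − 1 and v (the map φ of Defs).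
-- Accordingly a colouring is written i ∷ ((p ∷ʳ j) ++ q): the colour i of u, the colours p of the
-- inner vertices of the first path, the colour j of v and the colours q of those of the second.
module ThetaEmbedding (r₁ r₂ : ℕ) where

  n₁ n₂ : ℕ
  n₁ = suc (suc r₁)
  n₂ = suc (suc r₂)

  Θ : Graph
  Θ = ThetaGraph n₁ n₂

  e₁ : Fin n₁ → Fin (order Θ)
  e₁ x = x Fin.↑ˡ r₂

  v : Fin (order Θ)
  v = e₁ (fromℕ (suc r₁))

  path₂-tail : Vec (Fin (suc r₁ + r₂)) (suc r₂)
  path₂-tail = Vec.tabulate (suc r₁ Fin.↑ʳ_) ∷ʳ (fromℕ r₁ Fin.↑ˡ r₂)

  e₂ : Fin n₂ → Fin (order Θ)
  e₂ zero    = zero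
  e₂ (suc t) = suc (lookup path₂-tail t)

  e₂-last : e₂ (fromℕ (suc r₂)) ≡ v
  e₂-last = cong suc (lookup-∷ʳ-fromℕ (Vec.tabulate (suc r₁ Fin.↑ʳ_)) (fromℕ r₁ Fin.↑ˡ r₂))

  φ-last : φ n₁ n₂ (suc r₂) ≡ suc r₁
  φ-last rewrite dec-true (n₂ ≟ n₂) refl = refl

  φ-interior : ∀ {x} → x ≢ r₂ → φ n₁ n₂ (suc x) ≡ n₁ + x
  φ-interior {x} x≢r₂ rewrite dec-false (suc (suc x) ≟ n₂) (x≢r₂ ∘ suc-injective ∘ suc-injective) = refl

  toℕ-e₂ : ∀ t → toℕ (e₂ t) ≡ φ n₁ n₂ (toℕ t)
  toℕ-e₂ zero    = refl
  toℕ-e₂ (suc t) with lookup-∷ʳ (Vec.tabulate (suc r₁ Fin.↑ʳ_)) (fromℕ r₁ Fin.↑ˡ r₂) t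
  ... | inj₁ (t≡r₂ , eq) = begin
    suc (toℕ (lookup path₂-tail t))   ≡⟨ cong (suc ∘ toℕ) eq ⟩
    suc (toℕ (fromℕ r₁ Fin.↑ˡ r₂))    ≡⟨ cong suc (trans (Finₚ.toℕ-↑ˡ (fromℕ r₁) r₂) (Finₚ.toℕ-fromℕ r₁)) ⟩
    suc r₁                            ≡˘⟨ φ-last ⟩
    φ n₁ n₂ (suc r₂)                  ≡˘⟨ cong (φ n₁ n₂ ∘ suc) t≡r₂ ⟩
    φ n₁ n₂ (suc (toℕ t))             ∎
    where open ≡-Reasoning
  ... | inj₂ (u , u≡t , eq) = begin
    suc (toℕ (lookup path₂-tail t))                       ≡⟨ cong (suc ∘ toℕ) eq ⟩
    suc (toℕ (lookup (Vec.tabulate (suc r₁ Fin.↑ʳ_)) u))  ≡⟨ cong (suc ∘ toℕ) (Vecₚ.lookup∘tabulate (suc r₁ Fin.↑ʳ_) u) ⟩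
    suc (toℕ (suc r₁ Fin.↑ʳ u))                           ≡⟨ cong suc (Finₚ.toℕ-↑ʳ (suc r₁) u) ⟩
    n₁ + toℕ u                                            ≡⟨ cong (n₁ +_) u≡t ⟩
    n₁ + toℕ t                                            ≡˘⟨ φ-interior (λ t≡r₂ → <-irrefl (trans u≡t t≡r₂) (Finₚ.toℕ<n u)) ⟩
    φ n₁ n₂ (suc (toℕ t))                                 ∎
    where open ≡-Reasoning

  e₁-adj : ∀ {x y} → Adj (Cycle n₁) x y → Adj Θ (e₁ x) (e₁ y)
  e₁-adj {x} {y} xy = inj₁ (x , y , sym (Finₚ.toℕ-↑ˡ x r₂) , sym (Finₚ.toℕ-↑ˡ y r₂) , xy)

  e₂-adj : ∀ {x y} → Adj (Cycle n₂) x y → Adj Θ (e₂ x) (e₂ y)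
  e₂-adj {x} {y} xy = inj₂ (x , y , sym (toℕ-e₂ x) , sym (toℕ-e₂ y) , xy)

  module _ (Q : Fin (order Θ) → Fin (order Θ) → Set) where

    theta-edges⇔ : (∀ a b → Adj Θ a b → Q a b) ⇔
                   ((∀ x y → Adj (Cycle n₁) x y → Q (e₁ x) (e₁ y)) × (∀ x y → Adj (Cycle n₂) x y → Q (e₂ x) (e₂ y)))
    theta-edges⇔ = mk⇔
      (λ h → (λ x y xy → h (e₁ x) (e₁ y) (e₁-adj xy)) , (λ x y xy → h (e₂ x) (e₂ y) (e₂-adj xy)))
      λ { (h₁ , h₂) a b (inj₁ (x , y , x≡a , y≡b , xy)) →
            subst₂ Q (Finₚ.toℕ-injective (trans (Finₚ.toℕ-↑ˡ x r₂) x≡a))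
                     (Finₚ.toℕ-injective (trans (Finₚ.toℕ-↑ˡ y r₂) y≡b)) (h₁ x y xy)
        ; (h₁ , h₂) a b (inj₂ (x , y , x≡a , y≡b , xy)) →
            subst₂ Q (Finₚ.toℕ-injective (trans (toℕ-e₂ x) x≡a))
                     (Finₚ.toℕ-injective (trans (toℕ-e₂ y) y≡b)) (h₂ x y xy) }

  module _ {A : Set} (i : A) (p : Vec A r₁) (j : A) (q : Vec A r₂) where

    lookup-e₁ : ∀ t → lookup (i ∷ ((p ∷ʳ j) Vec.++ q)) (e₁ t) ≡ lookup (i ∷ (p ∷ʳ j)) t
    lookup-e₁ = Vecₚ.lookup-++ˡ (i ∷ (p ∷ʳ j)) q

    lookup-e₂ : ∀ t → lookup (i ∷ ((p ∷ʳ j) Vec.++ q)) (e₂ t) ≡ lookup (i ∷ (q ∷ʳ j)) t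
    lookup-e₂ zero    = refl
    lookup-e₂ (suc t) = trans (sym (Vecₚ.lookup-map t (lookup c) path₂-tail)) (cong (λ w → lookup w t) walk₂)
      where
      c : Vec A (suc r₁ + r₂)
      c = (p ∷ʳ j) Vec.++ q
      walk₂ : Vec.map (lookup c) path₂-tail ≡ q ∷ʳ j
      walk₂ = begin
        Vec.map (lookup c) (Vec.tabulate (suc r₁ Fin.↑ʳ_) ∷ʳ (fromℕ r₁ Fin.↑ˡ r₂))
          ≡⟨ Vecₚ.map-∷ʳ (lookup c) (fromℕ r₁ Fin.↑ˡ r₂) (Vec.tabulate (suc r₁ Fin.↑ʳ_)) ⟩
        Vec.map (lookup c) (Vec.tabulate (suc r₁ Fin.↑ʳ_)) ∷ʳ lookup c (fromℕ r₁ Fin.↑ˡ r₂)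
          ≡˘⟨ cong (_∷ʳ lookup c (fromℕ r₁ Fin.↑ˡ r₂)) (Vecₚ.tabulate-∘ (lookup c) (suc r₁ Fin.↑ʳ_)) ⟩
        Vec.tabulate (lookup c ∘ (suc r₁ Fin.↑ʳ_)) ∷ʳ lookup c (fromℕ r₁ Fin.↑ˡ r₂)
          ≡⟨ cong₂ _∷ʳ_ (trans (Vecₚ.tabulate-cong (Vecₚ.lookup-++ʳ (p ∷ʳ j) q)) (Vecₚ.tabulate∘lookup q))
                        (trans (Vecₚ.lookup-++ˡ (p ∷ʳ j) q (fromℕ r₁)) (lookup-∷ʳ-fromℕ p j)) ⟩
        q ∷ʳ j
          ∎
        where open ≡-Reasoning

module ThetaCount {r₁ r₂ : ℕ} (H : Cover (ThetaGraph (suc (suc r₁)) (suc (suc r₂))) m) where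
  open ThetaEmbedding r₁ r₂

  links₁ : Fin (suc r₁) → Link m
  links₁ = pathLinks H e₁

  links₂ : Fin (suc r₂) → Link m
  links₂ = pathLinks H e₂

  uvLink : Link m
  uvLink = M H zero v

  isHColoring-theta : ∀ i p j q → isHColoring H (i ∷ ((p ∷ʳ j) Vec.++ q)) ≡
                      not (uvLink i j) ∧ (avoids links₁ (i ∷ (p ∷ʳ j)) ∧ avoids links₂ (i ∷ (q ∷ʳ j)))
  isHColoring-theta i p j q = ≡true⇔⇒≡ (begin
    isHColoring H c ≡ true
      ∼⟨ isHColoring⇔Proper H c ⟩
    Proper H c
      ∼⟨ theta-edges⇔ Fine ⟩
    ((∀ x y → Adj (Cycle n₁) x y → Fine (e₁ x) (e₁ y)) × (∀ x y → Adj (Cycle n₂) x y → Fine (e₂ x) (e₂ y)))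
      ∼⟨ embeddedCycle⇔ H e₁ c w₁ (lookup-e₁ i p j q) ×-⇔ embeddedCycle⇔ H e₂ c w₂ (lookup-e₂ i p j q) ⟩
    ((uvLink i (lookup w₁ (fromℕ (suc r₁))) ≡ false × avoids links₁ w₁ ≡ true) ×
     (M H zero (e₂ (fromℕ (suc r₂))) i (lookup w₂ (fromℕ (suc r₂))) ≡ false × avoids links₂ w₂ ≡ true))
      ≡⟨ cong₂ _×_ (cong (λ u → uvLink i u ≡ false × avoids links₁ w₁ ≡ true) (lookup-∷ʳ-fromℕ p j))
                   (cong₂ (λ u u′ → M H zero u i u′ ≡ false × avoids links₂ w₂ ≡ true) e₂-last (lookup-∷ʳ-fromℕ q j)) ⟩
    ((uvLink i j ≡ false × avoids links₁ w₁ ≡ true) × (uvLink i j ≡ false × avoids links₂ w₂ ≡ true))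
      ∼⟨ mk⇔ (λ ((τ , a₁) , (_ , a₂)) → τ , a₁ , a₂) (λ (τ , a₁ , a₂) → (τ , a₁) , (τ , a₂)) ⟩
    (uvLink i j ≡ false × (avoids links₁ w₁ ≡ true × avoids links₂ w₂ ≡ true))
      ∼⟨ ⇔-sym (⇔-id _ ×-⇔ ∧≡true⇔) ⟩
    (uvLink i j ≡ false × (avoids links₁ w₁ ∧ avoids links₂ w₂) ≡ true)
      ∼⟨ ⇔-sym not∧≡true⇔ ⟩
    (not (uvLink i j) ∧ (avoids links₁ w₁ ∧ avoids links₂ w₂)) ≡ true
      ∎)
    where
    open EquationalReasoning
    c : Vec (Fin m) (order Θ)
    c = i ∷ ((p ∷ʳ j) Vec.++ q)
    w₁ : Vec (Fin m) n₁
    w₁ = i ∷ (p ∷ʳ j)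
    w₂ : Vec (Fin m) n₂
    w₂ = i ∷ (q ∷ʳ j)
    Fine : Fin (order Θ) → Fin (order Θ) → Set
    Fine a b = M H a b (lookup c a) (lookup c b) ≡ false

  theta-fixedEnds : ∀ i j → ∑ⱽ r₁ (λ p → ∑ⱽ r₂ (λ q → ⟦ isHColoring H (i ∷ ((p ∷ʳ j) Vec.++ q)) ⟧)) ≡
                    ⟦ not (uvLink i j) ⟧ * (pathCount links₁ i j * pathCount links₂ i j)
  theta-fixedEnds i j = begin
    ∑ⱽ r₁ (λ p → ∑ⱽ r₂ (λ q → ⟦ isHColoring H (i ∷ ((p ∷ʳ j) Vec.++ q)) ⟧))
      ≡⟨ ∑ⱽ-cong r₁ (λ p → ∑ⱽ-cong r₂ (λ q → split p q)) ⟩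
    ∑ⱽ r₁ (λ p → ∑ⱽ r₂ (λ q → τ * (A₁ p * A₂ q)))
      ≡⟨ ∑ⱽ-cong r₁ (λ p → ∑ⱽ-*ˡ r₂ τ (λ q → A₁ p * A₂ q)) ⟩
    ∑ⱽ r₁ (λ p → τ * ∑ⱽ r₂ (λ q → A₁ p * A₂ q))
      ≡⟨ ∑ⱽ-*ˡ r₁ τ (λ p → ∑ⱽ r₂ (λ q → A₁ p * A₂ q)) ⟩
    τ * ∑ⱽ r₁ (λ p → ∑ⱽ r₂ (λ q → A₁ p * A₂ q))
      ≡⟨ cong (τ *_) (∑ⱽ-product r₁ r₂ A₁ A₂) ⟩
    τ * (∑ⱽ r₁ A₁ * ∑ⱽ r₂ A₂)
      ≡⟨ cong (τ *_) (cong₂ _*_ (∑ⱽ-avoids r₁ links₁ i j) (∑ⱽ-avoids r₂ links₂ i j)) ⟩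
    τ * (pathCount links₁ i j * pathCount links₂ i j)
      ∎
    where
    open ≡-Reasoning
    τ : ℕ
    τ = ⟦ not (uvLink i j) ⟧
    A₁ : Vec (Fin m) r₁ → ℕ
    A₁ p = ⟦ avoids links₁ (i ∷ (p ∷ʳ j)) ⟧
    A₂ : Vec (Fin m) r₂ → ℕ
    A₂ q = ⟦ avoids links₂ (i ∷ (q ∷ʳ j)) ⟧
    split : ∀ p q → ⟦ isHColoring H (i ∷ ((p ∷ʳ j) Vec.++ q)) ⟧ ≡ τ * (A₁ p * A₂ q)
    split p q = trans (cong ⟦_⟧ (isHColoring-theta i p j q))
                      (trans (⟦∧⟧ (not (uvLink i j)) _) (cong (τ *_) (⟦∧⟧ (avoids links₁ (i ∷ (p ∷ʳ j))) _)))

  theta-count : numColorings H ≡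
                ∑[ j < m ] ∑[ i < m ] (⟦ not (uvLink i j) ⟧ * (pathCount links₁ i j * pathCount links₂ i j))
  theta-count = begin
    numColorings H
      ≡⟨ numColorings-∑ⱽ H ⟩
    ∑[ i < m ] ∑ⱽ (suc r₁ + r₂) (λ x → ⟦ isHColoring H (i ∷ x) ⟧)
      ≡⟨ sum-cong-≗ (λ i → ∑ⱽ-++ (suc r₁) r₂ (λ x → ⟦ isHColoring H (i ∷ x) ⟧)) ⟩
    ∑[ i < m ] ∑ⱽ (suc r₁) (λ p → ∑ⱽ r₂ (λ q → ⟦ isHColoring H (i ∷ (p Vec.++ q)) ⟧))
      ≡⟨ sum-cong-≗ (λ i → ∑ⱽ-∷ʳ r₁ (λ p → ∑ⱽ r₂ (λ q → ⟦ isHColoring H (i ∷ (p Vec.++ q)) ⟧))) ⟩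
    ∑[ i < m ] ∑ⱽ r₁ (λ p → ∑[ j < m ] ∑ⱽ r₂ (λ q → ⟦ isHColoring H (i ∷ ((p ∷ʳ j) Vec.++ q)) ⟧))
      ≡⟨ sum-cong-≗ (λ i → ∑ⱽ-comm r₁ (λ p j → ∑ⱽ r₂ (λ q → ⟦ isHColoring H (i ∷ ((p ∷ʳ j) Vec.++ q)) ⟧))) ⟩
    ∑[ i < m ] ∑[ j < m ] ∑ⱽ r₁ (λ p → ∑ⱽ r₂ (λ q → ⟦ isHColoring H (i ∷ ((p ∷ʳ j) Vec.++ q)) ⟧))
      ≡⟨ sum-cong-≗ (λ i → sum-cong-≗ (λ j → theta-fixedEnds i j)) ⟩
    ∑[ i < m ] ∑[ j < m ] (⟦ not (uvLink i j) ⟧ * (pathCount links₁ i j * pathCount links₂ i j))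
      ≡⟨ ∑-comm (λ i j → ⟦ not (uvLink i j) ⟧ * (pathCount links₁ i j * pathCount links₂ i j)) ⟩
    ∑[ j < m ] ∑[ i < m ] (⟦ not (uvLink i j) ⟧ * (pathCount links₁ i j * pathCount links₂ i j))
      ∎
    where
    open ≡-Reasoning

-- Matchings

IsMatching : Link m → Set
IsMatching R = (∀ {i y y′} → R i y ≡ true → R i y′ ≡ true → y ≡ y′) ×
               (∀ {i i′ y} → R i y ≡ true → R i′ y ≡ true → i ≡ i′)

==-isMatching : IsMatching (_==_ {m})
==-isMatching = (λ {i} i≡y i≡y′ → trans (sym (==⇒≡ {i = i} i≡y)) (==⇒≡ i≡y′))
              , (λ {i} {i′} i≡y i′≡y → trans (==⇒≡ {i = i} i≡y) (sym (==⇒≡ {i = i′} i′≡y)))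

flip-isMatching : {R : Link m} → IsMatching R → IsMatching (flip R)
flip-isMatching (unique-col , unique-row) = unique-row , unique-col

cover-isMatching : {G : Graph} (H : Cover G m) → ∀ a b → IsMatching (M H a b)
cover-isMatching H a b = (λ {i} {y} {y′} → M-matchʳ H a b i y y′) , (λ {i} {i′} {y} → M-matchˡ H a b i i′ y)

row-view : (R : Link m) (i : Fin m) → (∃ λ y → R i y ≡ true) ⊎ (∀ y → R i y ≡ false)
row-view R i with Finₚ.any? (λ y → R i y Bool.≟ true)
... | yes matched = inj₁ matched
... | no  ¬matched = inj₂ (λ y → Boolₚ.¬-not (λ e → ¬matched (y , e)))

-- Otherwise the partners of the rows would inject the m rows into the m − 1 columns other than p.
emptyColumn⇒emptyRow : {R : Link m} → IsMatching R → ∀ p → (∀ i → R i p ≡ false) → ∃ λ i → ∀ y → R i y ≡ false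
emptyColumn⇒emptyRow {suc m} {R} (_ , unique-row) p empty
  with Finₚ.any? (λ i → Finₚ.all? (λ y → R i y Bool.≟ false))
... | yes found = found
... | no  none  = contradiction (Finₚ.pigeonhole (n<1+n m) (λ i → Fin.punchOut (p≢partner i))) collision
  where
  partner : ∀ i → ∃ λ y → R i y ≡ true
  partner i with row-view R i
  ... | inj₁ matched = matched
  ... | inj₂ unmatched = contradiction (i , unmatched) none
  p≢partner : ∀ i → p ≢ proj₁ (partner i)
  p≢partner i p≡y = contradiction (trans (sym (proj₂ (partner i))) (trans (cong (R i) (sym p≡y)) (empty i))) λ ()
  collision : ¬ (∃ λ i → ∃ λ i′ → i Fin.< i′ × Fin.punchOut (p≢partner i) ≡ Fin.punchOut (p≢partner i′))
  collision (i , i′ , i<i′ , eq) = Finₚ.<⇒≢ i<i′ (unique-row (proj₂ (partner i))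
    (subst (λ y → R i′ y ≡ true) (sym (Finₚ.punchOut-injective (p≢partner i) (p≢partner i′) eq)) (proj₂ (partner i′))))

step-mono-≤ : (R : Link m) {f g : Fin m → ℕ} → (∀ y → f y ≤ g y) → ∀ i → step R f i ≤ step R g i
step-mono-≤ R f≤g i = sum-mono-≤ (λ y → *-monoʳ-≤ ⟦ not (R i y) ⟧ (f≤g y))

step-unmatched : (R : Link m) (f : Fin m → ℕ) {i : Fin m} → (∀ y → R i y ≡ false) → step R f i ≡ sum f
step-unmatched R f unmatched = sum-cong-≗ (λ y → trans (cong (λ b → ⟦ not b ⟧ * f y) (unmatched y)) (+-identityʳ (f y)))

step-matched : {R : Link m} → IsMatching R → (f : Fin m → ℕ) {i y₀ : Fin m} → R i y₀ ≡ true →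
               step R f i + f y₀ ≡ sum f
step-matched {R = R} (unique-col , _) f {i} {y₀} R-i-y₀ = begin
  step R f i + f y₀                                               ≡˘⟨ cong (step R f i +_) (sum-select f y₀) ⟩
  step R f i + ∑[ y < _ ] (⟦ y == y₀ ⟧ * f y)                     ≡˘⟨ ∑-distrib-+ (λ y → ⟦ not (R i y) ⟧ * f y) _ ⟩
  ∑[ y < _ ] (⟦ not (R i y) ⟧ * f y + ⟦ y == y₀ ⟧ * f y)          ≡⟨ sum-cong-≗ one-of ⟩
  sum f                                                           ∎
  where
  open ≡-Reasoning
  one-of : ∀ y → ⟦ not (R i y) ⟧ * f y + ⟦ y == y₀ ⟧ * f y ≡ f y
  one-of y with y Fin.≟ y₀
  ... | yes refl rewrite R-i-y₀ = +-identityʳ (f y)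
  ... | no  y≢y₀ with R i y in R-i-y
  ...   | true  = contradiction (unique-col R-i-y R-i-y₀) y≢y₀
  ...   | false = trans (+-identityʳ (f y + 0)) (+-identityʳ (f y))

step-const-≤ : (R : Link m) {f : Fin m → ℕ} {A : ℕ} {π : Fin m} → (∀ y → A ≤ ⟦ y == π ⟧ + f y) →
               ∀ i → step R (λ _ → A) i ≤ ⟦ not (R i π) ⟧ + step R f i
step-const-≤ {m} R {f} {A} {π} A≤f+δ i = begin
  step R (λ _ → A) i
    ≤⟨ step-mono-≤ R A≤f+δ i ⟩
  step R (λ y → ⟦ y == π ⟧ + f y) i
    ≡⟨ sum-cong-≗ (λ y → *-distribˡ-+ ⟦ not (R i y) ⟧ ⟦ y == π ⟧ (f y)) ⟩
  ∑[ y < m ] (⟦ not (R i y) ⟧ * ⟦ y == π ⟧ + ⟦ not (R i y) ⟧ * f y)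
    ≡⟨ ∑-distrib-+ (λ y → ⟦ not (R i y) ⟧ * ⟦ y == π ⟧) (λ y → ⟦ not (R i y) ⟧ * f y) ⟩
  ∑[ y < m ] (⟦ not (R i y) ⟧ * ⟦ y == π ⟧) + step R f i
    ≡⟨ cong (_+ step R f i) select ⟩
  ⟦ not (R i π) ⟧ + step R f i
    ∎
  where
  open ≤-Reasoning
  select : ∑[ y < m ] (⟦ not (R i y) ⟧ * ⟦ y == π ⟧) ≡ ⟦ not (R i π) ⟧
  select = trans (sum-cong-≗ (λ y → *-comm ⟦ not (R i y) ⟧ ⟦ y == π ⟧)) (sum-select (λ y → ⟦ not (R i y) ⟧) π)

bump-cancel : ∀ d s {A B} → s + (d + A) ≡ 1 + (A + B) → d + s ≡ B + 1
bump-cancel d s {A} {B} eq = +-cancelʳ-≡ A _ _ (trans (shuffle d s A) (trans eq (shuffle′ A B)))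
  where
  shuffle : ∀ d s A → d + s + A ≡ s + (d + A)
  shuffle = solve-∀
  shuffle′ : ∀ A B → 1 + (A + B) ≡ B + 1 + A
  shuffle′ = solve-∀

dip-cancel : ∀ d s f {A B} → 1 ≤ B → d + f ≡ A → 1 + (s + f) ≡ A + B → s ≡ d + (B ∸ 1)
dip-cancel d s f {A} {B} 1≤B d+f≡A eq = +-cancelˡ-≡ 1 _ _ (+-cancelʳ-≡ f _ _ (begin
  1 + s + f             ≡⟨ +-assoc 1 s f ⟩
  1 + (s + f)           ≡⟨ eq ⟩
  A + B                 ≡˘⟨ cong (_+ B) d+f≡A ⟩
  d + f + B             ≡˘⟨ cong (d + f +_) (m+[n∸m]≡n 1≤B) ⟩
  d + f + (1 + (B ∸ 1)) ≡⟨ shuffle d f (B ∸ 1) ⟩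
  1 + (d + (B ∸ 1)) + f ∎))
  where
  open ≡-Reasoning
  shuffle : ∀ d f c → d + f + (1 + c) ≡ 1 + (d + c) + f
  shuffle = solve-∀

column-owner : {R : Link m} → IsMatching R → ∀ p → ∃ λ π → ∀ {i} → R i p ≡ true → i ≡ π
column-owner {R = R} (_ , unique-row) p with row-view (flip R) p
... | inj₁ (i₀ , R-i₀-p) = i₀ , λ R-i-p → unique-row R-i-p R-i₀-p
... | inj₂ empty         = p , λ R-i-p → contradiction (trans (sym R-i-p) (empty _)) λ ()

column-partner : {R : Link m} → IsMatching R → ∀ p → ∃ λ π → R π p ≡ true ⊎ (∀ y → R π y ≡ false)
column-partner {R = R} matching p with row-view (flip R) p
... | inj₁ (i₀ , R-i₀-p) = i₀ , inj₁ R-i₀-p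
... | inj₂ empty         = let i , unmatched = emptyColumn⇒emptyRow matching p empty in i , inj₂ unmatched

module StepBounds {m′ : ℕ} {R : Link (suc m′)} (matching : IsMatching R) where

  step-const-≥ : ∀ i c → m′ * c ≤ step R (λ _ → c) i
  step-const-≥ i c with row-view R i
  ... | inj₁ (y₀ , R-i-y₀) = ≤-reflexive (sym (+-cancelʳ-≡ c _ _ (trans (step-matched matching (λ _ → c) R-i-y₀)
                                                                  (trans (sum-const (suc m′) c) (+-comm c (m′ * c))))))
  ... | inj₂ unmatched     = ≤-trans (m≤n+m (m′ * c) c)
                                     (≤-reflexive (sym (trans (step-unmatched R (λ _ → c) unmatched) (sum-const (suc m′) c))))

  -- The deficit lands in the row matched to column π, if any.
  step-surplus : ∀ {f A π} → (∀ i → ⟦ i == π ⟧ + A ≤ f i) →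
                 ∃ λ π′ → ∀ i → m′ * A + 1 ≤ ⟦ i == π′ ⟧ + step R f i
  step-surplus {f} {A} {π} f≥g = π′ , λ i → ≤-trans (bound i) (+-monoʳ-≤ ⟦ i == π′ ⟧ (step-mono-≤ R f≥g i))
    where
    π′ : Fin (suc m′)
    π′ = proj₁ (column-owner matching π)
    g : Fin (suc m′) → ℕ
    g y = ⟦ y == π ⟧ + A
    owner : ∀ {i y₀} → R i y₀ ≡ true → ⟦ y₀ == π ⟧ ≤ ⟦ i == π′ ⟧
    owner {i} {y₀} R-i-y₀ with y₀ Fin.≟ π
    ... | yes refl rewrite proj₂ (column-owner matching π) R-i-y₀ | ==-refl π′ = ≤-refl
    ... | no  _    = z≤n
    bound : ∀ i → m′ * A + 1 ≤ ⟦ i == π′ ⟧ + step R g i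
    bound i with row-view R i
    ... | inj₂ unmatched = ≤-trans (≤-reflexive (+-comm (m′ * A) 1))
        (≤-trans (+-monoʳ-≤ 1 (m≤n+m (m′ * A) A))
        (≤-trans (≤-reflexive (sym (trans (step-unmatched R g unmatched) (sum-bump π A)))) (m≤n+m _ ⟦ i == π′ ⟧)))
    ... | inj₁ (y₀ , R-i-y₀) = ≤-trans (≤-reflexive (sym exact)) (+-monoˡ-≤ (step R g i) (owner R-i-y₀))
      where
      exact : ⟦ y₀ == π ⟧ + step R g i ≡ m′ * A + 1
      exact = bump-cancel ⟦ y₀ == π ⟧ (step R g i) (trans (step-matched matching g R-i-y₀) (sum-bump π A))

  -- The surplus lands in the row matched to column π or, if π is unmatched, in an unmatched row.
  step-deficit : .{{_ : NonZero m′}} → ∀ {f A π} → 1 ≤ A → (∀ i → A ≤ ⟦ i == π ⟧ + f i) →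
                 ∃ λ π′ → ∀ i → ⟦ i == π′ ⟧ + (m′ * A ∸ 1) ≤ step R f i
  step-deficit {f} {A} {π} 1≤A A≤f+δ = π′ , bound
    where
    π′ : Fin (suc m′)
    π′ = proj₁ (column-partner matching π)
    B : ℕ
    B = m′ * A
    1+[B∸1]≡B : 1 + (B ∸ 1) ≡ B
    1+[B∸1]≡B = m+[n∸m]≡n (≤-trans 1≤A (m≤n*m A m′))
    bound : ∀ i → ⟦ i == π′ ⟧ + (B ∸ 1) ≤ step R f i
    bound i with R i π in R-i-π
    ... | true = begin
      ⟦ i == π′ ⟧ + (B ∸ 1)    ≤⟨ +-monoˡ-≤ (B ∸ 1) (⟦⟧≤1 (i == π′)) ⟩
      1 + (B ∸ 1)              ≡⟨ 1+[B∸1]≡B ⟩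
      B                        ≤⟨ step-const-≥ i A ⟩
      step R (λ _ → A) i       ≤⟨ step-const-≤ R A≤f+δ i ⟩
      ⟦ not (R i π) ⟧ + step R f i ≡⟨ cong (λ b → ⟦ not b ⟧ + step R f i) R-i-π ⟩
      step R f i               ∎
      where open ≤-Reasoning
    ... | false with i Fin.≟ π′
    ...   | no _ =
      m≤n+o⇒m∸n≤o B 1 (≤-trans (step-const-≥ i A)
                        (≤-trans (step-const-≤ R A≤f+δ i) (≤-reflexive (cong (λ b → ⟦ not b ⟧ + step R f i) R-i-π))))
    ...   | yes refl with proj₂ (column-partner matching π)
    ...     | inj₁ R-π′-π = contradiction (trans (sym R-π′-π) R-i-π) λ ()
    ...     | inj₂ unmatched = +-cancelˡ-≤ 1 _ _ (begin
      1 + (1 + (B ∸ 1))        ≡⟨ cong suc 1+[B∸1]≡B ⟩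
      1 + B                    ≤⟨ +-monoˡ-≤ B 1≤A ⟩
      A + B                    ≡˘⟨ trans (step-unmatched R (λ _ → A) unmatched) (sum-const (suc m′) A) ⟩
      step R (λ _ → A) π′      ≤⟨ step-const-≤ R A≤f+δ π′ ⟩
      ⟦ not (R π′ π) ⟧ + step R f π′ ≡⟨ cong (λ b → ⟦ not b ⟧ + step R f π′) R-i-π ⟩
      1 + step R f π′          ∎)
      where open ≤-Reasoning

indicator-≤ : ∀ b {V} W e → V ≤ e + W → ⟦ b ⟧ * V ≤ ⟦ b ⟧ * W + e
indicator-≤ false W e _ = z≤n
indicator-≤ true  {V} W e V≤e+W = begin
  V + 0      ≡⟨ +-identityʳ V ⟩
  V          ≤⟨ V≤e+W ⟩
  e + W      ≡⟨ +-comm e W ⟩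
  W + e      ≡˘⟨ cong (_+ e) (+-identityʳ W) ⟩
  W + 0 + e  ∎
  where open ≤-Reasoning

product-lowerBound : ∀ {X Y} P₁ P₂ d₁ d₂ → d₁ ≤ 1 → X ≤ d₁ + P₁ → Y ≤ d₂ + P₂ →
                     X * Y ≤ (d₁ * Y + d₂ * X) + P₁ * P₂
product-lowerBound {X} {Y} P₁ P₂ d₁ d₂ d₁≤1 X≤d₁+P₁ Y≤d₂+P₂ with X ≤? P₁
... | yes X≤P₁ = begin
  X * Y                      ≤⟨ *-monoʳ-≤ X Y≤d₂+P₂ ⟩
  X * (d₂ + P₂)              ≡⟨ *-distribˡ-+ X d₂ P₂ ⟩
  X * d₂ + X * P₂            ≤⟨ +-mono-≤ (≤-reflexive (*-comm X d₂)) (*-monoˡ-≤ P₂ X≤P₁) ⟩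
  d₂ * X + P₁ * P₂           ≤⟨ +-monoˡ-≤ (P₁ * P₂) (m≤n+m (d₂ * X) (d₁ * Y)) ⟩
  (d₁ * Y + d₂ * X) + P₁ * P₂ ∎
  where open ≤-Reasoning
... | no X≰P₁ with d₁ | d₁≤1 | X≤d₁+P₁
...   | zero  | _       | X≤P₁  = contradiction X≤P₁ X≰P₁
...   | suc _ | s≤s z≤n | X≤1+P₁ = begin
  X * Y                      ≤⟨ *-monoˡ-≤ Y X≤1+P₁ ⟩
  (1 + P₁) * Y               ≤⟨ +-monoʳ-≤ Y (*-monoʳ-≤ P₁ Y≤d₂+P₂) ⟩
  Y + P₁ * (d₂ + P₂)         ≡⟨ cong (Y +_) (*-distribˡ-+ P₁ d₂ P₂) ⟩
  Y + (P₁ * d₂ + P₁ * P₂)    ≡˘⟨ +-assoc Y (P₁ * d₂) (P₁ * P₂) ⟩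
  Y + P₁ * d₂ + P₁ * P₂      ≤⟨ +-monoˡ-≤ (P₁ * P₂) (+-mono-≤ (≤-reflexive (sym (+-identityʳ Y)))
                                  (≤-trans (≤-reflexive (*-comm P₁ d₂)) (*-monoʳ-≤ d₂ (<⇒≤ (≰⇒> X≰P₁))))) ⟩
  (1 * Y + d₂ * X) + P₁ * P₂ ∎
  where open ≤-Reasoning

column-lowerBound : ∀ {m′} {τ : Link (suc m′)} → IsMatching τ → ∀ j {V} (W e : Fin (suc m′) → ℕ) →
                    (∀ i → V ≤ e i + W i) → m′ * V ≤ ∑[ i < suc m′ ] (⟦ not (τ i j) ⟧ * W i) + sum e
column-lowerBound {m′} {τ} matching j {V} W e V≤e+W = begin
  m′ * V
    ≤⟨ StepBounds.step-const-≥ (flip-isMatching matching) j V ⟩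
  ∑[ i < suc m′ ] (⟦ not (τ i j) ⟧ * V)
    ≤⟨ sum-mono-≤ (λ i → indicator-≤ (not (τ i j)) (W i) (e i) (V≤e+W i)) ⟩
  ∑[ i < suc m′ ] (⟦ not (τ i j) ⟧ * W i + e i)
    ≡⟨ ∑-distrib-+ (λ i → ⟦ not (τ i j) ⟧ * W i) e ⟩
  ∑[ i < suc m′ ] (⟦ not (τ i j) ⟧ * W i) + sum e
    ∎
  where open ≤-Reasoning

Coincide : Bool → Fin m → Fin m → Set
Coincide true  x y = x ≡ y
Coincide false x y = x ≢ y

surplus-blocked : ∀ e {x y j : Fin m} → Coincide e x y → (y == j) ≡ false → (e ∧ (x == j)) ≡ false
surplus-blocked true  refl y≠j = y≠j
surplus-blocked false _    _   = refl

deficit-unblocked : ∀ e {x y j : Fin m} → Coincide e x y → (y == j) ≡ true → (not e ∧ (x == j)) ≡ false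
deficit-unblocked true  _   _   = refl
deficit-unblocked false x≢y y≡j = ≢⇒==-false (λ x≡j → x≢y (trans x≡j (sym (==⇒≡ y≡j))))

disjoint-deficits : ∀ e₁ e₂ {i x j : Fin m} → (e₁ Bool.∨ e₂ ≡ false → x ≢ i) →
                    (not e₁ ∧ (i == j)) ≡ true → (not e₂ ∧ (x == j)) ≡ false
disjoint-deficits true  _     _   ()
disjoint-deficits false true  _   _   = refl
disjoint-deficits false false x≢i i≡j = ≢⇒==-false (λ x≡j → x≢i refl (trans x≡j (sym (==⇒≡ i≡j))))

cycle-cell : ∀ z d {s P A} → (z ≡ false → s ≡ false) → (z ≡ true → d ≡ false) →
             ⟦ d ⟧ + P ≡ ⟦ s ⟧ + A → ⟦ not z ⟧ * P + ⟦ d ⟧ + ⟦ z ⟧ * A ≡ A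
cycle-cell true  d {A = A} _ unblocked _ rewrite unblocked refl = +-identityʳ A
cycle-cell false d {P = P} blocked _ profile rewrite blocked refl =
  trans (+-identityʳ (P + 0 + ⟦ d ⟧)) (trans (cong (_+ ⟦ d ⟧) (+-identityʳ P)) (trans (+-comm P ⟦ d ⟧) profile))

product-cell : ∀ d₁ d₂ {P₁ P₂ A₁ A₂} → (d₁ ≡ true → d₂ ≡ false) →
               ⟦ d₁ ⟧ + P₁ ≡ A₁ → ⟦ d₂ ⟧ + P₂ ≡ A₂ → P₁ * P₂ + (⟦ d₁ ⟧ * A₂ + ⟦ d₂ ⟧ * A₁) ≡ A₁ * A₂
product-cell true  true  disjoint _    _    = contradiction (disjoint refl) λ ()
product-cell false false {P₁} {P₂} _ refl refl = +-identityʳ (P₁ * P₂)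
product-cell true  false {P₁} {P₂} _ refl refl =
  trans (cong (P₁ * P₂ +_) (trans (+-identityʳ (P₂ + 0)) (+-identityʳ P₂))) (+-comm (P₁ * P₂) P₂)
product-cell false true  {P₁} {P₂} _ refl refl =
  trans (cong (P₁ * P₂ +_) (+-identityʳ P₁)) (trans (+-comm (P₁ * P₂) P₁) (sym (*-suc P₁ P₂)))

theta-cell : ∀ z d₁ d₂ {s₁ s₂ P₁ P₂ A₁ A₂} →
             (z ≡ false → s₁ ≡ false × s₂ ≡ false) → (z ≡ true → d₁ ≡ false × d₂ ≡ false) → (d₁ ≡ true → d₂ ≡ false) →
             ⟦ d₁ ⟧ + P₁ ≡ ⟦ s₁ ⟧ + A₁ → ⟦ d₂ ⟧ + P₂ ≡ ⟦ s₂ ⟧ + A₂ →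
             ⟦ not z ⟧ * (P₁ * P₂) + (⟦ d₁ ⟧ * A₂ + ⟦ d₂ ⟧ * A₁) + ⟦ z ⟧ * (A₁ * A₂) ≡ A₁ * A₂
theta-cell true  d₁ d₂ {A₁ = A₁} {A₂ = A₂} _ unblocked _ _ _ with unblocked refl
... | refl , refl = +-identityʳ (A₁ * A₂)
theta-cell false d₁ d₂ {P₁ = P₁} {P₂ = P₂} {A₁} {A₂} blocked _ disjoint profile₁ profile₂ with blocked refl
... | refl , refl = trans (+-identityʳ _)
  (trans (cong (_+ (⟦ d₁ ⟧ * A₂ + ⟦ d₂ ⟧ * A₁)) (+-identityʳ (P₁ * P₂))) (product-cell d₁ d₂ disjoint profile₁ profile₂))

column-exact : ∀ {m′ V} (z : Fin (suc m′) → Bool) (W e : Fin (suc m′) → ℕ) →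
               (∀ i → ⟦ not (z i) ⟧ * W i + e i + ⟦ z i ⟧ * V ≡ V) → ∑[ i < suc m′ ] ⟦ z i ⟧ ≡ 1 →
               ∑[ i < suc m′ ] (⟦ not (z i) ⟧ * W i) + sum e ≡ m′ * V
column-exact {m′} {V} z W e cell sum-z = +-cancelʳ-≡ V _ _ (begin
  ∑[ i < suc m′ ] (⟦ not (z i) ⟧ * W i) + sum e + V
    ≡˘⟨ cong (∑[ i < suc m′ ] (⟦ not (z i) ⟧ * W i) + sum e +_)
             (trans (cong (_* V) sum-z) (+-identityʳ V)) ⟩
  ∑[ i < suc m′ ] (⟦ not (z i) ⟧ * W i) + sum e + ∑[ i < suc m′ ] ⟦ z i ⟧ * V
    ≡⟨ cong₂ _+_ (sym (∑-distrib-+ (λ i → ⟦ not (z i) ⟧ * W i) e)) (*-distribʳ-sum V (λ i → ⟦ z i ⟧)) ⟩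
  ∑[ i < suc m′ ] (⟦ not (z i) ⟧ * W i + e i) + ∑[ i < suc m′ ] (⟦ z i ⟧ * V)
    ≡˘⟨ ∑-distrib-+ (λ i → ⟦ not (z i) ⟧ * W i + e i) (λ i → ⟦ z i ⟧ * V) ⟩
  ∑[ i < suc m′ ] (⟦ not (z i) ⟧ * W i + e i + ⟦ z i ⟧ * V)
    ≡⟨ trans (sum-cong-≗ cell) (sum-const (suc m′) V) ⟩
  V + m′ * V
    ≡⟨ +-comm V (m′ * V) ⟩
  m′ * V + V
    ∎)
  where open ≡-Reasoning

-- Covers with permuted links

module LabelledCover (G : Graph) (adj? : ∀ a b → Dec (Adj G a b)) (adj-sym : ∀ {a b} → Adj G a b → Adj G b a)
                     (label : Fin (order G) → Fin (order G) → Permutation′ m) where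

  private
    link : Fin (order G) → Fin (order G) → Link m
    link a b i j = does (adj? a b) ∧ (label a b ⟨$⟩ʳ i == label b a ⟨$⟩ʳ j)

    adj?-sym : ∀ a b → does (adj? a b) ≡ does (adj? b a)
    adj?-sym a b with adj? a b | adj? b a
    ... | yes _   | yes _    = refl
    ... | no  _   | no  _    = refl
    ... | yes ab  | no  ¬ba  = contradiction (adj-sym ab) ¬ba
    ... | no  ¬ab | yes ba   = contradiction (adj-sym ba) ¬ab

    link-adj : ∀ a b i j → link a b i j ≡ true → Adj G a b
    link-adj a b i j eq with adj? a b
    ... | yes ab = ab

    label-injective : ∀ a b {i j} → label a b ⟨$⟩ʳ i ≡ label a b ⟨$⟩ʳ j → i ≡ j
    label-injective a b = Injection.injective (↔⇒↣ (label a b))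

    link-matched : ∀ {a b i j} → link a b i j ≡ true → label a b ⟨$⟩ʳ i ≡ label b a ⟨$⟩ʳ j
    link-matched {a} {b} eq = ==⇒≡ (proj₂ (Equivalence.to (∧≡true⇔ {does (adj? a b)}) eq))

  cover : Cover G m
  cover = record
    { M        = link
    ; M-sym    = λ a b i j → cong₂ _∧_ (adj?-sym a b) (==-sym (label a b ⟨$⟩ʳ i) (label b a ⟨$⟩ʳ j))
    ; M-adj    = link-adj
    ; M-matchʳ = λ a b i j j′ e e′ → label-injective b a (trans (sym (link-matched e)) (link-matched e′))
    ; M-matchˡ = λ a b i i′ j e e′ → label-injective a b (trans (link-matched e) (sym (link-matched e′)))
    }

  cover-link : ∀ {a b} → Adj G a b → ∀ i j → M cover a b i j ≡ (label a b ⟨$⟩ʳ i == label b a ⟨$⟩ʳ j)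
  cover-link {a} {b} ab i j rewrite dec-true (adj? a b) ab = refl

cycAdj? : ∀ n a b → Dec (CycAdj n a b)
cycAdj? n a b = (suc a ≟ b) ⊎-dec (suc b ≟ a) ⊎-dec ((a ≟ 0) ×-dec (suc b ≟ n)) ⊎-dec ((b ≟ 0) ×-dec (suc a ≟ n))

cycAdj-sym : ∀ {n a b} → CycAdj n a b → CycAdj n b a
cycAdj-sym (inj₁ e)                 = inj₂ (inj₁ e)
cycAdj-sym (inj₂ (inj₁ e))          = inj₁ e
cycAdj-sym (inj₂ (inj₂ (inj₁ e)))   = inj₂ (inj₂ (inj₂ e))
cycAdj-sym (inj₂ (inj₂ (inj₂ e)))   = inj₂ (inj₂ (inj₁ e))

thetaAdj? : ∀ n₁ n₂ a b → Dec (Adj (ThetaGraph n₁ n₂) a b)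
thetaAdj? n₁ n₂ a b =
  Finₚ.any? (λ x → Finₚ.any? (λ y → (toℕ x ≟ toℕ a) ×-dec (toℕ y ≟ toℕ b) ×-dec cycAdj? n₁ (toℕ x) (toℕ y)))
  ⊎-dec
  Finₚ.any? (λ x → Finₚ.any? (λ y → (φ n₁ n₂ (toℕ x) ≟ toℕ a) ×-dec (φ n₁ n₂ (toℕ y) ≟ toℕ b) ×-dec cycAdj? n₂ (toℕ x) (toℕ y)))

thetaAdj-sym : ∀ {n₁ n₂ a b} → Adj (ThetaGraph n₁ n₂) a b → Adj (ThetaGraph n₁ n₂) b a
thetaAdj-sym (inj₁ (x , y , x≡a , y≡b , xy)) = inj₁ (y , x , y≡b , x≡a , cycAdj-sym xy)
thetaAdj-sym (inj₂ (x , y , x≡a , y≡b , xy)) = inj₂ (y , x , y≡b , x≡a , cycAdj-sym xy)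

rotate⁻¹ : Fin (suc n) → Fin (suc n)
rotate⁻¹ zero    = fromℕ _
rotate⁻¹ (suc i) = inject₁ i

rotate : Fin (suc n) → Fin (suc n)
rotate {n} i with n ≟ toℕ i
... | yes _   = zero
... | no  n≢i = suc (Fin.lower₁ i n≢i)

toℕ-rotate : (i : Fin (suc n)) → (toℕ i ≡ n × toℕ (rotate i) ≡ 0) ⊎ (toℕ i ≢ n × toℕ (rotate i) ≡ suc (toℕ i))
toℕ-rotate {n} i with n ≟ toℕ i
... | yes n≡i = inj₁ (sym n≡i , refl)
... | no  n≢i = inj₂ (n≢i ∘ sym , cong suc (Finₚ.toℕ-lower₁ i n≢i))

rotate⁻¹-rotate : (i : Fin (suc n)) → rotate⁻¹ (rotate i) ≡ i
rotate⁻¹-rotate {n} i with n ≟ toℕ i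
... | yes n≡i = Finₚ.toℕ-injective (trans (Finₚ.toℕ-fromℕ n) n≡i)
... | no  n≢i = Finₚ.toℕ-injective (trans (Finₚ.toℕ-inject₁ _) (Finₚ.toℕ-lower₁ i n≢i))

rotate-rotate⁻¹ : (i : Fin (suc n)) → rotate (rotate⁻¹ i) ≡ i
rotate-rotate⁻¹ {n} zero with toℕ-rotate (fromℕ n)
... | inj₁ (_ , rot≡0)       = Finₚ.toℕ-injective rot≡0
... | inj₂ (last≢n , _)      = contradiction (Finₚ.toℕ-fromℕ n) last≢n
rotate-rotate⁻¹ {n} (suc i) with toℕ-rotate (inject₁ i)
... | inj₁ (i≡n , _)         = contradiction (sym i≡n) (Finₚ.toℕ-inject₁-≢ i)
... | inj₂ (_ , rot≡suc)     = Finₚ.toℕ-injective (trans rot≡suc (cong suc (Finₚ.toℕ-inject₁ i)))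

rotation : Permutation′ (suc n)
rotation = Permutation.permutation rotate rotate⁻¹ rotate-rotate⁻¹ rotate⁻¹-rotate

rotate-≢ : 1 ≤ n → (i : Fin (suc n)) → rotate i ≢ i
rotate-≢ 1≤n i rot≡i with toℕ-rotate i
... | inj₁ (i≡n , rot≡0)   = <⇒≢ 1≤n (trans (sym rot≡0) (trans (cong toℕ rot≡i) i≡n))
... | inj₂ (_ , rot≡suc)   = 1+n≢n (trans (sym rot≡suc) (cong toℕ rot≡i))

rotate²-≢ : 2 ≤ n → (i : Fin (suc n)) → rotate (rotate i) ≢ i
rotate²-≢ 2≤n i rot²≡i with toℕ-rotate i | toℕ-rotate (rotate i)
... | inj₁ (_ , r≡0)     | inj₁ (r≡n , _)    = <⇒≢ (≤-trans (s≤s z≤n) 2≤n) (trans (sym r≡0) r≡n)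
... | inj₁ (i≡n , r≡0)   | inj₂ (_ , rr≡r+1) =
  <⇒≢ 2≤n (sym (trans (sym i≡n) (trans (cong toℕ (sym rot²≡i)) (trans rr≡r+1 (cong suc r≡0)))))
... | inj₂ (_ , r≡i+1)   | inj₁ (r≡n , rr≡0) =
  <⇒≢ 2≤n (sym (trans (sym r≡n) (trans r≡i+1 (cong suc (trans (cong toℕ (sym rot²≡i)) rr≡0)))))
... | inj₂ (_ , r≡i+1)   | inj₂ (_ , rr≡r+1) =
  m+1+n≢m (toℕ i) {1} (trans (+-comm (toℕ i) 2) (trans (cong suc (sym r≡i+1)) (trans (sym rr≡r+1) (cong toℕ rot²≡i))))

module CycleCover {m : ℕ} (k′ : ℕ) (ρ : Permutation′ m) where

  label : Fin (3 + k′) → Fin (3 + k′) → Permutation′ m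
  label zero    b = if b == fromℕ (2 + k′) then ρ else Permutation.id
  label (suc _) _ = Permutation.id

  open LabelledCover (Cycle (3 + k′)) (λ a b → cycAdj? _ (toℕ a) (toℕ b)) cycAdj-sym label public
  open CycleCount cover

  links-identity : ∀ s i y → links s i y ≡ (i == y)
  links-identity zero    = cover-link {zero} {suc zero} (inj₁ refl)
  links-identity (suc s) = cover-link {suc (inject₁ s)} {suc (suc s)} (inj₁ (cong (2 +_) (Finₚ.toℕ-inject₁ s)))

  closingLink-ρ : ∀ i y → closingLink i y ≡ (ρ ⟨$⟩ʳ i == y)
  closingLink-ρ i y =
    trans (cover-link {zero} {fromℕ (2 + k′)} (inj₂ (inj₂ (inj₁ (refl , cong suc (Finₚ.toℕ-fromℕ (2 + k′)))))) i y)
                            (cong (λ b → (if b then ρ else Permutation.id) ⟨$⟩ʳ i == y) (==-refl (fromℕ (2 + k′))))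

  count : numColorings cover ≡ ∑[ j < m ] ∑[ i < m ] (⟦ not (ρ ⟨$⟩ʳ i == j) ⟧ * idPathCount (2 + k′) i j)
  count = trans cycle-count (sum-cong-≗ λ j → sum-cong-≗ λ i →
    cong₂ (λ b p → ⟦ not b ⟧ * p) (closingLink-ρ i j) (pathCount-cong (λ s → links-identity s) i j))

module ThetaCover {m : ℕ} (r₁′ r₂′ : ℕ) (ρ₀ ρ₂ : Permutation′ m) where
  open ThetaEmbedding (suc r₁′) (suc r₂′)

  first₂ : Fin (order Θ)
  first₂ = e₂ (suc zero)

  first₂≢v : first₂ ≢ v
  first₂≢v first₂≡v = 1+n≢n (begin
    suc (suc r₁′)                                  ≡˘⟨ cong suc (+-identityʳ (suc r₁′)) ⟩
    suc (suc r₁′ + 0)                              ≡˘⟨ cong suc (Finₚ.toℕ-↑ʳ (suc r₁′) zero) ⟩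
    suc (toℕ (suc r₁′ Fin.↑ʳ zero))                ≡⟨ suc-injective (cong toℕ first₂≡v) ⟩
    toℕ (fromℕ (suc r₁′) Fin.↑ˡ suc r₂′)           ≡⟨ Finₚ.toℕ-↑ˡ (fromℕ (suc r₁′)) (suc r₂′) ⟩
    toℕ (fromℕ (suc r₁′))                          ≡⟨ Finₚ.toℕ-fromℕ (suc r₁′) ⟩
    suc r₁′                                        ∎)
    where open ≡-Reasoning

  label : Fin (order Θ) → Fin (order Θ) → Permutation′ m
  label zero    b = if b == v then ρ₀ else if b == first₂ then ρ₂ else Permutation.id
  label (suc _) _ = Permutation.id

  open LabelledCover Θ (thetaAdj? n₁ n₂) thetaAdj-sym label public
  open ThetaCount cover

  links₁-identity : ∀ s i y → links₁ s i y ≡ (i == y)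
  links₁-identity zero    = cover-link (e₁-adj {zero} {suc zero} (inj₁ refl))
  links₁-identity (suc s) = cover-link (e₁-adj {suc (inject₁ s)} {suc (suc s)} (inj₁ (cong (2 +_) (Finₚ.toℕ-inject₁ s))))

  links₂-tail-identity : ∀ s i y → links₂ (suc s) i y ≡ (i == y)
  links₂-tail-identity s = cover-link (e₂-adj {suc (inject₁ s)} {suc (suc s)} (inj₁ (cong (2 +_) (Finₚ.toℕ-inject₁ s))))

  links₂-head : ∀ i y → links₂ zero i y ≡ (ρ₂ ⟨$⟩ʳ i == y)
  links₂-head i y rewrite cover-link (e₂-adj {zero} {suc zero} (inj₁ refl)) i y | ≢⇒==-false first₂≢v | ==-refl first₂ = refl

  uvLink-ρ₀ : ∀ i y → uvLink i y ≡ (ρ₀ ⟨$⟩ʳ i == y)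
  uvLink-ρ₀ i y
    rewrite cover-link (e₁-adj {zero} {fromℕ (2 + r₁′)} (inj₂ (inj₂ (inj₁ (refl , cong suc (Finₚ.toℕ-fromℕ _)))))) i y
          | ==-refl v = refl

  count : numColorings cover ≡
          ∑[ j < m ] ∑[ i < m ] (⟦ not (ρ₀ ⟨$⟩ʳ i == j) ⟧ *
            (idPathCount (2 + r₁′) i j * idPathCount (2 + r₂′) (ρ₂ ⟨$⟩ʳ i) j))
  count = trans theta-count (sum-cong-≗ λ j → sum-cong-≗ λ i →
    cong₂ (λ b p → ⟦ not b ⟧ * p) (uvLink-ρ₀ i j)
      (cong₂ _*_ (pathCount-cong links₁-identity i j)
                 (sum-cong-≗ λ y → cong₂ (λ b p → ⟦ not b ⟧ * p) (links₂-head i y)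
                                         (pathCount-cong links₂-tail-identity y j))))

-- Lower bounds and their sharpness

isEven : ℕ → Bool
isEven zero    = true
isEven (suc n) = not (isEven n)

module Bounds (m′ : ℕ) .{{_ : NonZero m′}} where

  a : ℕ → ℕ
  a zero    = 0
  a (suc L) = if isEven L then m′ * a L + 1 else m′ * a L ∸ 1

  a-odd-positive : ∀ L → isEven L ≡ false → 1 ≤ a L
  a-odd-positive (suc L) _ with isEven L
  ... | true = m≤n+m 1 (m′ * a L)

  LowerProfile : Bool → ℕ → (Fin (suc m′) → ℕ) → Set
  LowerProfile true  A f = ∃ λ π → ∀ i → ⟦ i == π ⟧ + A ≤ f i
  LowerProfile false A f = ∃ λ π → ∀ i → A ≤ ⟦ i == π ⟧ + f i

  pathCount-lowerProfile : ∀ L (Rs : Fin L → Link (suc m′)) → (∀ s → IsMatching (Rs s)) →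
                           ∀ j → LowerProfile (isEven L) (a L) (λ i → pathCount Rs i j)
  pathCount-lowerProfile zero    Rs matchings j = j , λ i → ≤-reflexive (+-identityʳ ⟦ i == j ⟧)
  pathCount-lowerProfile (suc L) Rs matchings j
    with isEven L in even? | pathCount-lowerProfile L (Rs ∘ suc) (matchings ∘ suc) j
  ... | true  | _ , bound = StepBounds.step-surplus (matchings zero) bound
  ... | false | _ , bound = StepBounds.step-deficit (matchings zero) (a-odd-positive L even?) bound

  identityPath-profile : ∀ L j i →
    ⟦ not (isEven L) ∧ (i == j) ⟧ + idPathCount L i j ≡ ⟦ isEven L ∧ (i == j) ⟧ + a L
  identityPath-profile zero    j i = sym (+-identityʳ ⟦ i == j ⟧)
  identityPath-profile (suc L) j i with isEven L in even? | identityPath-profile L j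
  ... | true  | profile = bump-cancel ⟦ i == j ⟧ (step _==_ f i) (begin
    step _==_ f i + (⟦ i == j ⟧ + a L) ≡˘⟨ cong (step _==_ f i +_) (profile i) ⟩
    step _==_ f i + f i                ≡⟨ step-matched ==-isMatching f {i} (==-refl i) ⟩
    sum f                              ≡⟨ trans (sum-cong-≗ profile) (sum-bump j (a L)) ⟩
    1 + (a L + m′ * a L)               ∎)
    where
    open ≡-Reasoning
    f : Fin (suc m′) → ℕ
    f y = idPathCount L y j
  ... | false | profile =
    dip-cancel ⟦ i == j ⟧ (step _==_ f i) (f i) (≤-trans (a-odd-positive L even?) (m≤n*m (a L) m′)) (profile i) (begin
    1 + (step _==_ f i + f i)          ≡⟨ cong suc (step-matched ==-isMatching f {i} (==-refl i)) ⟩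
    1 + sum f                          ≡˘⟨ cong (_+ sum f) (sum-indicator j) ⟩
    ∑[ y < suc m′ ] ⟦ y == j ⟧ + sum f ≡˘⟨ ∑-distrib-+ (λ y → ⟦ y == j ⟧) f ⟩
    ∑[ y < suc m′ ] (⟦ y == j ⟧ + f y) ≡⟨ trans (sum-cong-≗ profile) (sum-const (suc m′) (a L)) ⟩
    a L + m′ * a L                     ∎)
    where
    open ≡-Reasoning
    f : Fin (suc m′) → ℕ
    f y = idPathCount L y j

  a-closedForm : ∀ L → suc m′ * a L + ⟦ isEven L ⟧ ≡ m′ ^ L + ⟦ not (isEven L) ⟧
  a-closedForm zero = cong (_+ 1) (*-zeroʳ (suc m′))
  a-closedForm (suc L) with isEven L in even? | a-closedForm L
  ... | true  | ih = begin
    suc m′ * (m′ * a L + 1) + 0  ≡⟨ expand m′ (a L) ⟩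
    m′ * (suc m′ * a L + 1) + 1  ≡⟨ cong (λ x → m′ * x + 1) ih ⟩
    m′ * (m′ ^ L + 0) + 1        ≡⟨ cong (λ x → m′ * x + 1) (+-identityʳ (m′ ^ L)) ⟩
    m′ * m′ ^ L + 1              ∎
    where
    open ≡-Reasoning
    expand : ∀ m′ x → suc m′ * (m′ * x + 1) + 0 ≡ m′ * (suc m′ * x + 1) + 1
    expand = solve-∀
  ... | false | ih = +-cancelʳ-≡ m′ _ _ (begin
    suc m′ * B + 1 + m′          ≡⟨ expand m′ B ⟩
    suc m′ * (1 + B)             ≡⟨ cong (suc m′ *_) 1+B≡m′a ⟩
    suc m′ * (m′ * a L)          ≡⟨ swap m′ (a L) ⟩
    m′ * (suc m′ * a L + 0)      ≡⟨ cong (m′ *_) ih ⟩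
    m′ * (m′ ^ L + 1)            ≡⟨ *-distribˡ-+ m′ (m′ ^ L) 1 ⟩
    m′ * m′ ^ L + m′ * 1         ≡⟨ cong₂ _+_ (sym (+-identityʳ (m′ * m′ ^ L))) (*-identityʳ m′) ⟩
    m′ * m′ ^ L + 0 + m′         ∎)
    where
    open ≡-Reasoning
    B : ℕ
    B = m′ * a L ∸ 1
    1+B≡m′a : 1 + B ≡ m′ * a L
    1+B≡m′a = m+[n∸m]≡n (≤-trans (a-odd-positive L even?) (m≤n*m (a L) m′))
    expand : ∀ m′ b → suc m′ * b + 1 + m′ ≡ suc m′ * (1 + b)
    expand = solve-∀
    swap : ∀ m′ x → suc m′ * (m′ * x) ≡ m′ * (suc m′ * x + 0)
    swap = solve-∀

  a-closedForm-odd : ∀ L → isEven L ≡ false → suc m′ * a L ≡ m′ ^ L + 1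
  a-closedForm-odd L odd =
    trans (sym (+-identityʳ _)) (subst (λ e → suc m′ * a L + ⟦ e ⟧ ≡ m′ ^ L + ⟦ not e ⟧) odd (a-closedForm L))

  lowerProfile⇒deficit : ∀ e {A f} → LowerProfile e A f →
                         ∃ λ d → (∀ i → d i ≤ 1) × sum d ≡ ⟦ not e ⟧ × (∀ i → A ≤ d i + f i)
  lowerProfile⇒deficit true  {A} {f} (π , bound) =
    (λ _ → 0) , (λ _ → z≤n) , trans (sum-const (suc m′) 0) (*-zeroʳ (suc m′)) ,
    λ i → ≤-trans (m≤n+m A ⟦ i == π ⟧) (bound i)
  lowerProfile⇒deficit false (π , bound) = (λ i → ⟦ i == π ⟧) , (λ i → ⟦⟧≤1 (i == π)) , sum-indicator π , bound

  cycle-lowerBound : ∀ {k} (H : Cover (Cycle (suc (suc k))) (suc m′)) →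
                     suc m′ * (m′ * a (suc k)) ≤ numColorings H + suc m′ * ⟦ not (isEven (suc k)) ⟧
  cycle-lowerBound {k} H = begin
    suc m′ * (m′ * a L)                            ≤⟨ sum-lowerBound column-sum column ⟩
    sum column-sum + suc m′ * ⟦ not (isEven L) ⟧   ≡˘⟨ cong (_+ suc m′ * ⟦ not (isEven L) ⟧) cycle-count ⟩
    numColorings H + suc m′ * ⟦ not (isEven L) ⟧   ∎
    where
    open ≤-Reasoning
    open CycleCount H
    L : ℕ
    L = suc k
    column-sum : Fin (suc m′) → ℕ
    column-sum j = ∑[ i < suc m′ ] (⟦ not (closingLink i j) ⟧ * pathCount links i j)
    column : ∀ j → m′ * a L ≤ column-sum j + ⟦ not (isEven L) ⟧
    column j with lowerProfile⇒deficit (isEven L) (pathCount-lowerProfile L links (λ _ → cover-isMatching H _ _) j)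
    ... | d , _ , sum-d , bound = subst (λ x → m′ * a L ≤ column-sum j + x) sum-d
      (column-lowerBound (cover-isMatching H _ _) j (λ i → pathCount links i j) d bound)

  theta-lowerBound : ∀ {r₁ r₂} (H : Cover (ThetaGraph (suc (suc r₁)) (suc (suc r₂))) (suc m′)) →
                     suc m′ * (m′ * (a (suc r₁) * a (suc r₂))) ≤
                     numColorings H + suc m′ * (⟦ not (isEven (suc r₁)) ⟧ * a (suc r₂) + ⟦ not (isEven (suc r₂)) ⟧ * a (suc r₁))
  theta-lowerBound {r₁} {r₂} H = begin
    suc m′ * (m′ * (a L₁ * a L₂))   ≤⟨ sum-lowerBound column-sum column ⟩
    sum column-sum + suc m′ * E     ≡˘⟨ cong (_+ suc m′ * E) theta-count ⟩
    numColorings H + suc m′ * E     ∎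
    where
    open ≤-Reasoning
    open ThetaCount H
    L₁ L₂ E : ℕ
    L₁ = suc r₁
    L₂ = suc r₂
    E = ⟦ not (isEven L₁) ⟧ * a L₂ + ⟦ not (isEven L₂) ⟧ * a L₁
    column-sum : Fin (suc m′) → ℕ
    column-sum j = ∑[ i < suc m′ ] (⟦ not (uvLink i j) ⟧ * (pathCount links₁ i j * pathCount links₂ i j))
    column : ∀ j → m′ * (a L₁ * a L₂) ≤ column-sum j + E
    column j
      with lowerProfile⇒deficit (isEven L₁) (pathCount-lowerProfile L₁ links₁ (λ _ → cover-isMatching H _ _) j)
         | lowerProfile⇒deficit (isEven L₂) (pathCount-lowerProfile L₂ links₂ (λ _ → cover-isMatching H _ _) j)
    ... | d₁ , d₁≤1 , sum-d₁ , bound₁ | d₂ , _ , sum-d₂ , bound₂ = subst (λ x → m′ * (a L₁ * a L₂) ≤ column-sum j + x) sum-e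
      (column-lowerBound (cover-isMatching H _ _) j (λ i → pathCount links₁ i j * pathCount links₂ i j) e
         (λ i → product-lowerBound (pathCount links₁ i j) (pathCount links₂ i j) (d₁ i) (d₂ i) (d₁≤1 i) (bound₁ i) (bound₂ i)))
      where
      e : Fin (suc m′) → ℕ
      e i = d₁ i * a L₂ + d₂ i * a L₁
      sum-e : sum e ≡ E
      sum-e = trans (∑-distrib-+ (λ i → d₁ i * a L₂) (λ i → d₂ i * a L₁))
                    (cong₂ _+_ (trans (sym (*-distribʳ-sum (a L₂) d₁)) (cong (_* a L₂) sum-d₁))
                               (trans (sym (*-distribʳ-sum (a L₁) d₂)) (cong (_* a L₁) sum-d₂)))

  cycle-exact : ∀ k′ (ρ : Permutation′ (suc m′)) → (∀ i → Coincide (isEven (2 + k′)) i (ρ ⟨$⟩ʳ i)) →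
                numColorings (CycleCover.cover k′ ρ) + suc m′ * ⟦ not (isEven (2 + k′)) ⟧ ≡ suc m′ * (m′ * a (2 + k′))
  cycle-exact k′ ρ coincide = trans (cong (_+ suc m′ * ⟦ not e ⟧) (CycleCover.count k′ ρ))
                                (sum-exact (λ j → ∑[ i < suc m′ ] (⟦ not (ρ ⟨$⟩ʳ i == j) ⟧ * idPathCount L i j)) column)
    where
    L : ℕ
    L = 2 + k′
    e : Bool
    e = isEven L
    column : ∀ j → ∑[ i < suc m′ ] (⟦ not (ρ ⟨$⟩ʳ i == j) ⟧ * idPathCount L i j) + ⟦ not e ⟧ ≡ m′ * a L
    column j = trans (cong (∑[ i < suc m′ ] (⟦ not (ρ ⟨$⟩ʳ i == j) ⟧ * idPathCount L i j) +_)
                           (sym (sum-permuted-indicator Permutation.id (not e) j)))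
      (column-exact (λ i → ρ ⟨$⟩ʳ i == j) (λ i → idPathCount L i j) (λ i → ⟦ not e ∧ (i == j) ⟧)
        (λ i → cycle-cell (ρ ⟨$⟩ʳ i == j) (not e ∧ (i == j))
                 (surplus-blocked e (coincide i)) (deficit-unblocked e (coincide i)) (identityPath-profile L j i))
        (sum-permuted-indicator ρ true j))

  theta-exact : ∀ r₁′ r₂′ (ρ₀ ρ₂ : Permutation′ (suc m′)) →
                (∀ i → Coincide (isEven (2 + r₁′)) i (ρ₀ ⟨$⟩ʳ i)) →
                (∀ i → Coincide (isEven (2 + r₂′)) (ρ₂ ⟨$⟩ʳ i) (ρ₀ ⟨$⟩ʳ i)) →
                (isEven (2 + r₁′) Bool.∨ isEven (2 + r₂′) ≡ false → ∀ i → ρ₂ ⟨$⟩ʳ i ≢ i) →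
                numColorings (ThetaCover.cover r₁′ r₂′ ρ₀ ρ₂) +
                  suc m′ * (⟦ not (isEven (2 + r₁′)) ⟧ * a (2 + r₂′) + ⟦ not (isEven (2 + r₂′)) ⟧ * a (2 + r₁′))
                ≡ suc m′ * (m′ * (a (2 + r₁′) * a (2 + r₂′)))
  theta-exact r₁′ r₂′ ρ₀ ρ₂ coincide₁ coincide₂ apart =
    trans (cong (_+ suc m′ * E) (ThetaCover.count r₁′ r₂′ ρ₀ ρ₂)) (sum-exact column-sum column)
    where
    L₁ L₂ E : ℕ
    e₁ e₂ : Bool
    L₁ = 2 + r₁′
    L₂ = 2 + r₂′
    e₁ = isEven L₁
    e₂ = isEven L₂
    E = ⟦ not e₁ ⟧ * a L₂ + ⟦ not e₂ ⟧ * a L₁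
    column-sum : Fin (suc m′) → ℕ
    column-sum j = ∑[ i < suc m′ ] (⟦ not (ρ₀ ⟨$⟩ʳ i == j) ⟧ * (idPathCount L₁ i j * idPathCount L₂ (ρ₂ ⟨$⟩ʳ i) j))
    column : ∀ j → column-sum j + E ≡ m′ * (a L₁ * a L₂)
    column j = trans (cong (column-sum j +_) (sym sum-e))
      (column-exact (λ i → ρ₀ ⟨$⟩ʳ i == j) (λ i → idPathCount L₁ i j * idPathCount L₂ (ρ₂ ⟨$⟩ʳ i) j) e
        (λ i → theta-cell (ρ₀ ⟨$⟩ʳ i == j) (d₁ i) (d₂ i)
                 (λ unblocked → surplus-blocked e₁ (coincide₁ i) unblocked , surplus-blocked e₂ (coincide₂ i) unblocked)
                 (λ blocked → deficit-unblocked e₁ (coincide₁ i) blocked , deficit-unblocked e₂ (coincide₂ i) blocked)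
                 (disjoint-deficits e₁ e₂ (λ both-odd → apart both-odd i))
                 (identityPath-profile L₁ j i) (identityPath-profile L₂ j (ρ₂ ⟨$⟩ʳ i)))
        (sum-permuted-indicator ρ₀ true j))
      where
      d₁ d₂ : Fin (suc m′) → Bool
      d₁ i = not e₁ ∧ (i == j)
      d₂ i = not e₂ ∧ (ρ₂ ⟨$⟩ʳ i == j)
      e : Fin (suc m′) → ℕ
      e i = ⟦ d₁ i ⟧ * a L₂ + ⟦ d₂ i ⟧ * a L₁
      sum-e : sum e ≡ E
      sum-e = trans (∑-distrib-+ (λ i → ⟦ d₁ i ⟧ * a L₂) (λ i → ⟦ d₂ i ⟧ * a L₁)) (cong₂ _+_
        (trans (sym (*-distribʳ-sum (a L₂) (λ i → ⟦ d₁ i ⟧))) (cong (_* a L₂) (sum-permuted-indicator Permutation.id (not e₁) j)))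
        (trans (sym (*-distribʳ-sum (a L₁) (λ i → ⟦ d₂ i ⟧))) (cong (_* a L₁) (sum-permuted-indicator ρ₂ (not e₂) j))))

odd-paths-identity : ∀ {m′ k a₁ a₂ X₁ X₂} → suc m′ * a₁ ≡ X₁ + 1 → suc m′ * a₂ ≡ X₂ + 1 →
                     k + suc m′ * (a₂ + a₁) ≡ suc m′ * (m′ * (a₁ * a₂)) →
                     suc m′ * k + X₁ + X₂ + suc m′ + 1 ≡ m′ * (X₁ * X₂)
odd-paths-identity {m′} {k} {a₁} {a₂} {X₁} {X₂} h₁ h₂ hk = +-cancelʳ-≡ (m′ * X₁ + m′ * X₂ + m′) _ _ (begin
  suc m′ * k + X₁ + X₂ + suc m′ + 1 + (m′ * X₁ + m′ * X₂ + m′)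
    ≡⟨ regroup m′ k X₁ X₂ ⟩
  suc m′ * k + suc m′ * (X₂ + 1) + suc m′ * (X₁ + 1)
    ≡˘⟨ cong₂ (λ u v → suc m′ * k + suc m′ * u + suc m′ * v) h₂ h₁ ⟩
  suc m′ * k + suc m′ * (suc m′ * a₂) + suc m′ * (suc m′ * a₁)
    ≡⟨ collect m′ k a₁ a₂ ⟩
  suc m′ * (k + suc m′ * (a₂ + a₁))
    ≡⟨ cong (suc m′ *_) hk ⟩
  suc m′ * (suc m′ * (m′ * (a₁ * a₂)))
    ≡⟨ swap m′ a₁ a₂ ⟩
  m′ * (suc m′ * a₁ * (suc m′ * a₂))
    ≡⟨ cong₂ (λ u v → m′ * (u * v)) h₁ h₂ ⟩
  m′ * ((X₁ + 1) * (X₂ + 1))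
    ≡⟨ expand m′ X₁ X₂ ⟩
  m′ * (X₁ * X₂) + (m′ * X₁ + m′ * X₂ + m′)
    ∎)
  where
  open ≡-Reasoning
  regroup : ∀ m′ k x y → suc m′ * k + x + y + suc m′ + 1 + (m′ * x + m′ * y + m′) ≡
                         suc m′ * k + suc m′ * (y + 1) + suc m′ * (x + 1)
  regroup = solve-∀
  collect : ∀ m′ k a b → suc m′ * k + suc m′ * (suc m′ * b) + suc m′ * (suc m′ * a) ≡ suc m′ * (k + suc m′ * (b + a))
  collect = solve-∀
  swap : ∀ m′ a b → suc m′ * (suc m′ * (m′ * (a * b))) ≡ m′ * (suc m′ * a * (suc m′ * b))
  swap = solve-∀
  expand : ∀ m′ x y → m′ * ((x + 1) * (y + 1)) ≡ m′ * (x * y) + (m′ * x + m′ * y + m′)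
  expand = solve-∀

product-identity : ∀ {M m′ k a₁ a₂ p₁ p₂ c₁ c₂} → c₁ * c₂ ≡ 0 →
                   p₁ + M * c₁ ≡ M * (m′ * a₁) → p₂ + M * c₂ ≡ M * (m′ * a₂) →
                   k + M * (c₁ * a₂ + c₂ * a₁) ≡ M * (m′ * (a₁ * a₂)) → M * m′ * k ≡ p₁ * p₂
product-identity {M} {m′} {k} {a₁} {a₂} {p₁} {p₂} {c₁} {c₂} c₁c₂≡0 h₁ h₂ hk = +-cancelʳ-≡ S _ _ (begin
  M * m′ * k + S
    ≡˘⟨ trans (cong (λ t → M * m′ * k + S + (t + t)) T≡0) (+-identityʳ (M * m′ * k + S)) ⟩
  M * m′ * k + S + (T + T)
    ≡⟨ spread M m′ k p₁ p₂ c₁ c₂ ⟩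
  M * m′ * k + M * c₁ * (p₂ + M * c₂) + M * c₂ * (p₁ + M * c₁)
    ≡⟨ cong₂ (λ u v → M * m′ * k + M * c₁ * u + M * c₂ * v) h₂ h₁ ⟩
  M * m′ * k + M * c₁ * (M * (m′ * a₂)) + M * c₂ * (M * (m′ * a₁))
    ≡⟨ collect M m′ k a₁ a₂ c₁ c₂ ⟩
  M * m′ * (k + M * (c₁ * a₂ + c₂ * a₁))
    ≡⟨ cong (M * m′ *_) hk ⟩
  M * m′ * (M * (m′ * (a₁ * a₂)))
    ≡⟨ split M m′ a₁ a₂ ⟩
  M * (m′ * a₁) * (M * (m′ * a₂))
    ≡˘⟨ cong₂ _*_ h₁ h₂ ⟩
  (p₁ + M * c₁) * (p₂ + M * c₂)
    ≡⟨ expand M p₁ p₂ c₁ c₂ ⟩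
  p₁ * p₂ + S + T
    ≡⟨ cong (λ t → p₁ * p₂ + S + t) T≡0 ⟩
  p₁ * p₂ + S + 0
    ≡⟨ +-identityʳ (p₁ * p₂ + S) ⟩
  p₁ * p₂ + S
    ∎)
  where
  open ≡-Reasoning
  S T : ℕ
  S = M * (c₁ * p₂ + c₂ * p₁)
  T = M * M * (c₁ * c₂)
  T≡0 : T ≡ 0
  T≡0 = trans (cong (M * M *_) c₁c₂≡0) (*-zeroʳ (M * M))
  spread : ∀ M m′ k p₁ p₂ c₁ c₂ → M * m′ * k + M * (c₁ * p₂ + c₂ * p₁) + (M * M * (c₁ * c₂) + M * M * (c₁ * c₂)) ≡
                                  M * m′ * k + M * c₁ * (p₂ + M * c₂) + M * c₂ * (p₁ + M * c₁)
  spread = solve-∀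
  collect : ∀ M m′ k a₁ a₂ c₁ c₂ → M * m′ * k + M * c₁ * (M * (m′ * a₂)) + M * c₂ * (M * (m′ * a₁)) ≡
                                   M * m′ * (k + M * (c₁ * a₂ + c₂ * a₁))
  collect = solve-∀
  split : ∀ M m′ a₁ a₂ → M * m′ * (M * (m′ * (a₁ * a₂))) ≡ M * (m′ * a₁) * (M * (m′ * a₂))
  split = solve-∀
  expand : ∀ M p₁ p₂ c₁ c₂ → (p₁ + M * c₁) * (p₂ + M * c₂) ≡ p₁ * p₂ + M * (c₁ * p₂ + c₂ * p₁) + M * M * (c₁ * c₂)
  expand = solve-∀

isEven⇒2∣ : ∀ n → isEven n ≡ true → 2 ∣ n
isEven⇒2∣ zero          _    = divides 0 refl
isEven⇒2∣ (suc (suc n)) even = ∣m∣n⇒∣m+n (∣-refl {2}) (isEven⇒2∣ n (trans (sym (Boolₚ.not-involutive (isEven n))) even))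

2∣⇒isEven : ∀ n → 2 ∣ n → isEven n ≡ true
2∣⇒isEven zero          _   = refl
2∣⇒isEven (suc zero)    2∣1 = contradiction (∣1⇒≡1 2∣1) λ ()
2∣⇒isEven (suc (suc n)) 2∣n+2 = trans (Boolₚ.not-involutive (isEven n)) (2∣⇒isEven n (∣m+n∣m⇒∣n 2∣n+2 (∣-refl {2})))

IsPDP-intro : {G : Graph} (H₀ : Cover G m) {E V : ℕ} → numColorings H₀ + E ≡ V →
              (∀ H → V ≤ numColorings H + E) → IsPDP G m (numColorings H₀)
IsPDP-intro H₀ {E} exact lowerBound = (H₀ , refl) , λ H → +-cancelʳ-≤ E _ _ (≤-trans (≤-reflexive exact) (lowerBound H))

IsPDP-unique : {G : Graph} {p p′ : ℕ} → IsPDP G m p → IsPDP G m p′ → p ≡ p′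
IsPDP-unique ((H , H≡p) , p≤) ((H′ , H′≡p′) , p′≤) =
  ≤-antisym (≤-trans (p≤ H′) (≤-reflexive H′≡p′)) (≤-trans (p′≤ H) (≤-reflexive H≡p))

module Optimal (m′ : ℕ) (2≤m′ : 2 ≤ m′) where

  1≤m′ : 1 ≤ m′
  1≤m′ = ≤-trans (s≤s z≤n) 2≤m′

  private instance
    m′-nonZero : NonZero m′
    m′-nonZero = >-nonZero 1≤m′

  open Bounds m′

  cycleShift : Bool → Permutation′ (suc m′)
  cycleShift true  = Permutation.id
  cycleShift false = rotation

  cycleShift-coincides : ∀ e i → Coincide e i (cycleShift e ⟨$⟩ʳ i)
  cycleShift-coincides true  i = refl
  cycleShift-coincides false i = rotate-≢ 1≤m′ i ∘ sym

  -- In column j, row i is blocked by the uv-link when ρ₀ i = j, and the paths deviate from a at the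
  -- rows i = j and ρ₂ i = j: surplus rows (even paths) must be blocked, deficit rows (odd paths)
  -- unblocked and distinct.
  thetaShifts : Bool → Bool → Permutation′ (suc m′) × Permutation′ (suc m′)
  thetaShifts true  true  = Permutation.id , Permutation.id
  thetaShifts true  false = Permutation.id , rotation
  thetaShifts false true  = rotation , rotation
  thetaShifts false false = rotation ∘ₚ rotation , rotation

  thetaShifts-coincide : ∀ e₁ e₂ → let ρ₀ , ρ₂ = thetaShifts e₁ e₂ in
    (∀ i → Coincide e₁ i (ρ₀ ⟨$⟩ʳ i)) × (∀ i → Coincide e₂ (ρ₂ ⟨$⟩ʳ i) (ρ₀ ⟨$⟩ʳ i)) ×
    (e₁ Bool.∨ e₂ ≡ false → ∀ i → ρ₂ ⟨$⟩ʳ i ≢ i)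
  thetaShifts-coincide true  true  = (λ _ → refl) , (λ _ → refl) , λ ()
  thetaShifts-coincide true  false = (λ _ → refl) , rotate-≢ 1≤m′ , λ ()
  thetaShifts-coincide false true  = (λ i → rotate-≢ 1≤m′ i ∘ sym) , (λ _ → refl) , λ ()
  thetaShifts-coincide false false =
    (λ i → rotate²-≢ 2≤m′ i ∘ sym) , (λ i → rotate-≢ 1≤m′ (rotate i) ∘ sym) , λ _ → rotate-≢ 1≤m′

  cycle-PDP : ∀ k′ {p} → IsPDP (Cycle (3 + k′)) (suc m′) p →
              p + suc m′ * ⟦ not (isEven (2 + k′)) ⟧ ≡ suc m′ * (m′ * a (2 + k′))
  cycle-PDP k′ pdp = trans (cong (_+ suc m′ * ⟦ not e ⟧) (IsPDP-unique pdp (IsPDP-intro H₀ exact cycle-lowerBound))) exact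
    where
    e : Bool
    e = isEven (2 + k′)
    H₀ : Cover (Cycle (3 + k′)) (suc m′)
    H₀ = CycleCover.cover k′ (cycleShift e)
    exact : numColorings H₀ + suc m′ * ⟦ not e ⟧ ≡ suc m′ * (m′ * a (2 + k′))
    exact = cycle-exact k′ (cycleShift e) (cycleShift-coincides e)

  -- Opaque, as otherwise Agda normalises the colouring count of the explicit cover when using k.
  opaque
    theta-PDP : ∀ r₁′ r₂′ → Σ ℕ λ k → IsPDP (ThetaGraph (3 + r₁′) (3 + r₂′)) (suc m′) k ×
                k + suc m′ * (⟦ not (isEven (2 + r₁′)) ⟧ * a (2 + r₂′) + ⟦ not (isEven (2 + r₂′)) ⟧ * a (2 + r₁′))
                ≡ suc m′ * (m′ * (a (2 + r₁′) * a (2 + r₂′)))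
    theta-PDP r₁′ r₂′ =
      numColorings H₀ , IsPDP-intro H₀ exact (theta-lowerBound {suc r₁′} {suc r₂′}) , exact
      where
      shifts : Permutation′ (suc m′) × Permutation′ (suc m′)
      shifts = thetaShifts (isEven (2 + r₁′)) (isEven (2 + r₂′))
      H₀ : Cover (ThetaGraph (3 + r₁′) (3 + r₂′)) (suc m′)
      H₀ = ThetaCover.cover r₁′ r₂′ (proj₁ shifts) (proj₂ shifts)
      exact : numColorings H₀ + suc m′ * (⟦ not (isEven (2 + r₁′)) ⟧ * a (2 + r₂′) + ⟦ not (isEven (2 + r₂′)) ⟧ * a (2 + r₁′))
              ≡ suc m′ * (m′ * (a (2 + r₁′) * a (2 + r₂′)))
      exact = let coincide₁ , coincide₂ , apart = thetaShifts-coincide (isEven (2 + r₁′)) (isEven (2 + r₂′)) in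
              theta-exact r₁′ r₂′ (proj₁ shifts) (proj₂ shifts) coincide₁ coincide₂ apart

  theta-PDP-oddPaths : ∀ r₁′ r₂′ → isEven (2 + r₁′) ≡ false → isEven (2 + r₂′) ≡ false →
    Σ ℕ λ k → IsPDP (ThetaGraph (3 + r₁′) (3 + r₂′)) (suc m′) k ×
              suc m′ * k + m′ ^ (2 + r₁′) + m′ ^ (2 + r₂′) + suc m′ + 1 ≡ m′ ^ (2 + r₁′ + (3 + r₂′))
  theta-PDP-oddPaths r₁′ r₂′ odd₁ odd₂ with theta-PDP r₁′ r₂′
  ... | k , pdp , exact = k , pdp ,
    trans (odd-paths-identity {m′} {k} {a L₁} {a L₂} {m′ ^ L₁} {m′ ^ L₂}
                              (a-closedForm-odd L₁ odd₁) (a-closedForm-odd L₂ odd₂) correction)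
          (sym power)
    where
    L₁ L₂ : ℕ
    L₁ = 2 + r₁′
    L₂ = 2 + r₂′
    correction : k + suc m′ * (a L₂ + a L₁) ≡ suc m′ * (m′ * (a L₁ * a L₂))
    correction = trans (cong (λ x → k + suc m′ * x) (sym (cong₂ _+_ (*-identityˡ (a L₂)) (*-identityˡ (a L₁)))))
      (subst₂ (λ e₁ e₂ → k + suc m′ * (⟦ not e₁ ⟧ * a L₂ + ⟦ not e₂ ⟧ * a L₁) ≡ suc m′ * (m′ * (a L₁ * a L₂)))
              odd₁ odd₂ exact)
    power : m′ ^ (L₁ + suc L₂) ≡ m′ * (m′ ^ L₁ * m′ ^ L₂)
    power = trans (cong (m′ ^_) (+-suc L₁ L₂)) (cong (m′ *_) (^-distribˡ-+-* m′ L₁ L₂))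

  theta-PDP-product : ∀ r₁′ r₂′ → ⟦ not (isEven (2 + r₁′)) ⟧ * ⟦ not (isEven (2 + r₂′)) ⟧ ≡ 0 →
    ∀ {p₁ p₂} → IsPDP (Cycle (3 + r₁′)) (suc m′) p₁ → IsPDP (Cycle (3 + r₂′)) (suc m′) p₂ →
    Σ ℕ λ k → IsPDP (ThetaGraph (3 + r₁′) (3 + r₂′)) (suc m′) k × suc m′ * m′ * k ≡ p₁ * p₂
  theta-PDP-product r₁′ r₂′ not-both-odd {p₁} {p₂} pdp₁ pdp₂ with theta-PDP r₁′ r₂′
  ... | k , pdp , exact =
    k , pdp , product-identity {suc m′} {m′} {k} {a (2 + r₁′)} {a (2 + r₂′)} {p₁} {p₂}
                                {⟦ not (isEven (2 + r₁′)) ⟧} {⟦ not (isEven (2 + r₂′)) ⟧}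
                                not-both-odd (cycle-PDP r₁′ pdp₁) (cycle-PDP r₂′ pdp₂) exact

proposition15 : (n₁ n₂ m : ℕ) → 3 ≤ n₁ → 3 ≤ n₂ → 3 ≤ m →
    ((2 ∣ n₁ × 2 ∣ n₂) →
      Σ ℕ λ k → IsPDP (ThetaGraph n₁ n₂) m k ×
        (m * k + (m ∸ 1) ^ (n₁ ∸ 1) + (m ∸ 1) ^ (n₂ ∸ 1) + m + 1 ≡ (m ∸ 1) ^ (n₁ + n₂ ∸ 1)))
    × (¬ (2 ∣ n₁ × 2 ∣ n₂) →
      ∀ p₁ p₂ → IsPDP (Cycle n₁) m p₁ → IsPDP (Cycle n₂) m p₂ →
      Σ ℕ λ k → IsPDP (ThetaGraph n₁ n₂) m k × (m * (m ∸ 1) * k ≡ p₁ * p₂))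
proposition15 (suc (suc (suc r₁′))) (suc (suc (suc r₂′))) (suc (suc (suc q))) (s≤s (s≤s (s≤s _))) (s≤s (s≤s (s≤s _))) (s≤s (s≤s (s≤s _))) =
  (λ (2∣n₁ , 2∣n₂) → theta-PDP-oddPaths r₁′ r₂′ (odd-path 2∣n₁) (odd-path 2∣n₂)) ,
  (λ ¬both p₁ p₂ → theta-PDP-product r₁′ r₂′ (not-both-odd ¬both))
  where
  open Optimal (suc (suc q)) (s≤s (s≤s z≤n))
  odd-path : ∀ {L} → 2 ∣ suc L → isEven L ≡ false
  odd-path {L} 2∣L+1 = trans (sym (Boolₚ.not-involutive (isEven L))) (cong not (2∣⇒isEven (suc L) 2∣L+1))
  not-both-odd : ¬ (2 ∣ 3 + r₁′ × 2 ∣ 3 + r₂′) → ⟦ not (isEven (2 + r₁′)) ⟧ * ⟦ not (isEven (2 + r₂′)) ⟧ ≡ 0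
  not-both-odd ¬both with isEven (2 + r₁′) in e₁ | isEven (2 + r₂′) in e₂
  ... | true  | _     = refl
  ... | false | true  = refl
  ... | false | false = contradiction (isEven⇒2∣ (3 + r₁′) (cong not e₁) , isEven⇒2∣ (3 + r₂′) (cong not e₂)) ¬both
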